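{- Let $\varepsilon\in(0,1)$, let $G$ and $H$ be forests on $n$ vertices, and let $G'$ and $H'$ be obtained from $G$ and $H$, respectively, by the partitioning construction with parameter $\varepsilon/4$. If $d(G,H)=0$ then $d(G',H')=0$. If $d(G,H)\ge\varepsilon n$ then $d(G',H')\ge \varepsilon n/2$.
   Context: Partitioning construction with parameter $\varepsilon'$ applied to a forest $G$: set $s=11/\varepsilon'$. A vertex $v$ is high-degree if $\deg_G(v)>s$ and low-degree otherwise; let $V_h,V_l$ be the sets of high- and low-degree vertices. A connected component of $G[V_l]$ is large if it has more than $s$ vertices and small otherwise. $G'$ is obtained from $G$ by: removing all edges with both endpoints in $V_h$; for each small component $C$ of $G[V_l]$ adjacent in $G$ to two or more vertices of $V_h$, removing all edges between $C$ and $V_h$; and removing all edges between large components of $G[V_l]$ and $V_h$. For graphs $G,H$ with the same number of vertices, $d(G,H)$ is the minimum number of edge additions and removals needed to make $G$ isomorphic to $H$. -}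

module Defs where

open import Data.Bool using (Bool; true; false; _∧_; _∨_; not; if_then_else_)
open import Data.Nat as ℕ using (ℕ; zero; suc; _<ᵇ_)
open import Data.Fin as Fin using (Fin; toℕ)
open import Data.List using (List; []; _∷_; length; filter; allFin; concatMap; map)
open import Data.Bool.ListAction using (any)
open import Data.Empty using (⊥)
open import Data.List.Relation.Unary.Unique.Propositional using (Unique)
open import Data.Integer using (+_)
open import Data.Rational using (ℚ; 0ℚ; _<_; _≤_; _÷_; _*_; _/_; Positive; positive; NonZero)
open import Data.Rational.Properties using (_<?_; pos⇒nonZero; pos*pos⇒pos)
open import Data.Fin.Permutation using (Permutation′; _⟨$⟩ʳ_)
open import Data.Product using (Σ; _×_; _,_)
open import Relation.Nullary using (¬_; does)
open import Relation.Binary.PropositionalEquality using (_≡_)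

Adj : ℕ → Set
Adj n = Fin n → Fin n → Bool

countᵇ : ∀ {A : Set} → (A → Bool) → List A → ℕ
countᵇ p []       = 0
countᵇ p (x ∷ xs) = if p x then suc (countᵇ p xs) else countᵇ p xs

_==ᶠ_ : ∀ {n} → Fin n → Fin n → Bool
u ==ᶠ v = does (u Fin.≟ v)

ℕtoℚ : ℕ → ℚ
ℕtoℚ m = (+ m) / 1

-- a cycle: a list of k ≥ 3 distinct vertices v₀ … v_{k-1} with
-- vᵢ adjacent to vᵢ₊₁ (indices mod k)
consecAdj : ∀ {n} → Adj n → Fin n → List (Fin n) → Set
consecAdj A first []           = ⊥
consecAdj A first (x ∷ [])     = A x first ≡ true
consecAdj A first (x ∷ y ∷ xs) = (A x y ≡ true) × consecAdj A first (y ∷ xs)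

IsCycle : ∀ {n} → Adj n → List (Fin n) → Set
IsCycle A []       = ⊥
IsCycle A (v ∷ vs) = (2 ℕ.≤ length vs) × Unique (v ∷ vs) × consecAdj A v (v ∷ vs)

IsForest : ∀ {n} → Adj n → Set
IsForest {n} A =
  (∀ u v → A u v ≡ A v u) ×
  (∀ u → A u u ≡ false) ×
  (∀ (c : List (Fin n)) → ¬ IsCycle A c)

-- Edit distance d(G,H): minimum over bijections σ of the number of
-- unordered pairs {i,j} (i<j) on which G and H∘σ disagree.

pairs : ∀ n → List (Fin n × Fin n)
pairs n = concatMap (λ i → map (λ j → i , j) (filter (λ j → toℕ i ℕ.<? toℕ j) (allFin n))) (allFin n)

xor : Bool → Bool → Bool
xor a b = if a then not b else b

editCount : ∀ {n} → Adj n → Adj n → Permutation′ n → ℕ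
editCount {n} G H σ =
  countᵇ (λ { (i , j) → xor (G i j) (H (σ ⟨$⟩ʳ i) (σ ⟨$⟩ʳ j)) }) (pairs n)

IsDist : ∀ {n} → Adj n → Adj n → ℕ → Set
IsDist {n} G H k =
  Σ (Permutation′ n) (λ σ → editCount G H σ ≡ k) ×
  (∀ (σ : Permutation′ n) → k ℕ.≤ editCount G H σ)

module Partition {n : ℕ} (s : ℚ) (G : Adj n) where

  deg : Fin n → ℕ
  deg v = countᵇ (G v) (allFin n)

  high : Fin n → Bool
  high v = does (s <? ℕtoℚ (deg v))

  low : Fin n → Bool
  low v = not (high v)

  reach : ℕ → Fin n → Fin n → Bool
  reach zero    u v = low u ∧ (u ==ᶠ v)
  reach (suc k) u v = reach k u v ∨ any (λ w → reach k u w ∧ G w v ∧ low v) (allFin n)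

  -- v lies in the connected component of G[V_l] containing the low vertex u
  sameComp : Fin n → Fin n → Bool
  sameComp u v = reach n u v

  compSize : Fin n → ℕ
  compSize u = countᵇ (sameComp u) (allFin n)

  large : Fin n → Bool
  large u = does (s <? ℕtoℚ (compSize u))

  highNbrs : Fin n → ℕ
  highNbrs u = countᵇ (λ h → high h ∧ any (λ v → sameComp u v ∧ G v h) (allFin n)) (allFin n)

  keepLH : Fin n → Bool
  keepLH l = not (large l) ∧ (highNbrs l <ᵇ 2)

  keep : Fin n → Fin n → Bool
  keep u v = if high u then (if high v then false else keepLH v)
                       else (if high v then keepLH u else true)

  G' : Adj n
  G' u v = G u v ∧ keep u v

partitionConstruction : ∀ {n} (ε' : ℚ) → .{{Positive ε'}} → Adj n → Adj n
partitionConstruction ε' G =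
  Partition.G' ((ℕtoℚ 11 ÷ ε') {{pos⇒nonZero ε'}}) G

quarter : ℚ → ℚ
quarter ε = ε * ((+ 1) / 4)

quarter-pos : ∀ ε → 0ℚ < ε → Positive (quarter ε)
quarter-pos ε ε>0 = pos*pos⇒pos ε {{positive ε>0}} ((+ 1) / 4)

module Submission where

-- If σ is an isomorphism G ≅ H, everything the construction looks at (degrees, components of the
-- low-degree part, their sizes and high-degree neighbours) is transported by σ, so σ is also an
-- isomorphism G' ≅ H'.
--
-- For the second claim, d(G,H) ≤ |E(G) △ E(G')| + d(G',H') + |E(H) △ E(H')|, so it suffices to bound
-- the number of removed edges. Let V_h be the high-degree vertices and B the low-degree vertices whose
-- component loses its edges to V_h. Every removed edge lies in the forest G[V_h ∪ B], which has at
-- most |V_h| + |B| edges, while G[B] keeps all of its edges and, having c connected components, has at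
-- least |B| − c of them; so at most |V_h| + c edges are removed. Each of these c components is large
-- (there are at most n/s such) or sends removed edges to two high-degree vertices (there are at most
-- half as many such components as removed edges). Hence at most 2|V_h| + 2n/s ≤ 6n/s edges are
-- removed, that is 3εn/22 for s = 44/ε, and d(G',H') ≥ εn − 3εn/11 ≥ εn/2.

open import Defs

module Combinatorics where
  open import Data.Bool using (Bool; true; false; _∧_; _∨_; not; if_then_else_)
  open import Data.Bool.Properties using (∧-zeroʳ; ∧-identityʳ; ∨-assoc; ∨-idem; T-≡)
  open import Function.Bundles using (Equivalence)
  open import Data.Bool.ListAction using (any)
  open import Data.Nat using (ℕ; zero; suc; _+_; _*_; _≤_; _<_; z≤n; s≤s; _<ᵇ_; _<?_; _≤?_)
  open import Data.Nat.Properties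
  open import Data.Nat.Tactic.RingSolver using (solve-∀)
  open import Algebra.Properties.Semiring.Sum +-*-semiring
    using (sum; ∑-distrib-+; ∑-comm; ∑-permute; sum-cong-≗; *-distribˡ-sum; *-distribʳ-sum)
  open import Data.Rational using (ℚ)
  import Data.Rational.Properties as ℚ
  open import Data.Fin as Fin using (Fin; toℕ)
  open import Data.Fin.Properties using (toℕ-injective)
  open import Data.Fin.Permutation using (Permutation′; _⟨$⟩ʳ_; _⟨$⟩ˡ_; inverseʳ; inverseˡ)
  open import Data.List using (List; []; _∷_; _++_; length; map; filter; concatMap; tabulate; allFin)
  open import Data.List.Relation.Unary.All using (All; []; _∷_)
  open import Data.List.Relation.Unary.AllPairs using ([]; _∷_)
  open import Data.List.Relation.Unary.Unique.Propositional using (Unique)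
  open import Data.List.Relation.Unary.Any using (here; there)
  open import Data.List.Membership.Propositional.Properties using (∈-∃++)
  open import Data.List.Relation.Unary.All.Properties.Core using (¬Any⇒All¬)
  open import Data.List.Properties using (length-++)
  open import Data.Unit using (⊤; tt)
  open import Data.Product using (∃; _×_; _,_; proj₁; proj₂)
  open import Data.Sum using (_⊎_; inj₁; inj₂)
  open import Data.Empty using (⊥; ⊥-elim)
  open import Function using (_∘_)
  open import Relation.Nullary using (¬_; Dec; does; yes; no)
  open import Relation.Nullary.Decidable using (dec-true; dec-false)
  open import Relation.Binary.PropositionalEquality hiding ([_])
  open import Relation.Binary.Definitions using (tri<; tri≈; tri>)

  ∧-elimˡ : ∀ {a b} → a ∧ b ≡ true → a ≡ true
  ∧-elimˡ {true} _ = refl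

  ∧-elimʳ : ∀ {a b} → a ∧ b ≡ true → b ≡ true
  ∧-elimʳ {true} ab = ab

  ∧-intro : ∀ {a b} → a ≡ true → b ≡ true → a ∧ b ≡ true
  ∧-intro refl refl = refl

  ∨-elim : ∀ {a b} → a ∨ b ≡ true → a ≡ true ⊎ b ≡ true
  ∨-elim {true} _ = inj₁ refl
  ∨-elim {false} b = inj₂ b

  ∨-introˡ : ∀ {a} b → a ≡ true → a ∨ b ≡ true
  ∨-introˡ b refl = refl

  ∨-introʳ : ∀ a {b} → b ≡ true → a ∨ b ≡ true
  ∨-introʳ true _ = refl
  ∨-introʳ false b = b

  not≡true⇒≡false : ∀ {a} → not a ≡ true → a ≡ false
  not≡true⇒≡false {false} _ = refl

  ≡false⇒not≡true : ∀ {a} → a ≡ false → not a ≡ true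
  ≡false⇒not≡true refl = refl

  true≢false : ∀ {a} → a ≡ true → a ≡ false → ⊥
  true≢false refl ()

  ≢true⇒≡false : ∀ {a} → ¬ a ≡ true → a ≡ false
  ≢true⇒≡false {false} _ = refl
  ≢true⇒≡false {true} a≢true = ⊥-elim (a≢true refl)

  ≢false⇒≡true : ∀ {a} → ¬ a ≡ false → a ≡ true
  ≢false⇒≡true {true} _ = refl
  ≢false⇒≡true {false} a≢false = ⊥-elim (a≢false refl)

  true-ext : ∀ {a b} → (a ≡ true → b ≡ true) → (b ≡ true → a ≡ true) → a ≡ b
  true-ext {false} {false} _ _ = refl
  true-ext {false} {true} _ b⇒a = b⇒a refl
  true-ext {true} a⇒b _ = sym (a⇒b refl)

  [_] : Bool → ℕ
  [ true ] = 1
  [ false ] = 0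

  []≤1 : ∀ b → [ b ] ≤ 1
  []≤1 true = ≤-refl
  []≤1 false = z≤n

  []-mono : ∀ {a b} → (a ≡ true → b ≡ true) → [ a ] ≤ [ b ]
  []-mono {false} a⇒b = z≤n
  []-mono {true} a⇒b rewrite a⇒b refl = ≤-refl

  []+[]≤[] : ∀ {p q r} → (p ≡ true → r ≡ true) → (q ≡ true → r ≡ true) → (p ≡ true → q ≡ true → ⊥) →
    [ p ] + [ q ] ≤ [ r ]
  []+[]≤[] {false} _ q⇒r _ = []-mono q⇒r
  []+[]≤[] {true} {false} p⇒r _ _ = []-mono p⇒r
  []+[]≤[] {true} {true} _ _ excl = ⊥-elim (excl refl refl)

  []*[]≤ : ∀ a b {x} → (a ≡ true → b ≡ true → 1 ≤ x) → [ a ] * [ b ] ≤ x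
  []*[]≤ false _ _ = z≤n
  []*[]≤ true false _ = z≤n
  []*[]≤ true true 1≤x = 1≤x refl refl

  []-subadditive : ∀ {r s t} → (r ≡ true → s ≡ true ⊎ t ≡ true) → [ r ] ≤ [ s ] + [ t ]
  []-subadditive {false} _ = z≤n
  []-subadditive {true} {s} r⇒s∨t with r⇒s∨t refl
  ... | inj₁ refl = s≤s z≤n
  ... | inj₂ refl = m≤n+m 1 [ s ]

  [∧]-subadditive : ∀ l {r s t} → (r ≡ true → s ≡ true ⊎ t ≡ true) → [ l ∧ r ] ≤ [ l ∧ s ] + [ l ∧ t ]
  [∧]-subadditive false _ = z≤n
  [∧]-subadditive true r⇒s∨t = []-subadditive r⇒s∨t

  [∧]≡[]*[] : ∀ a b → [ a ∧ b ] ≡ [ a ] * [ b ]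
  [∧]≡[]*[] false b = refl
  [∧]≡[]*[] true b = sym (+-identityʳ [ b ])

  sum-mono-≤ : ∀ {n} {f g : Fin n → ℕ} → (∀ i → f i ≤ g i) → sum f ≤ sum g
  sum-mono-≤ {zero} f≤g = z≤n
  sum-mono-≤ {suc n} f≤g = +-mono-≤ (f≤g Fin.zero) (sum-mono-≤ (f≤g ∘ Fin.suc))

  sum-zero : ∀ {n} {f : Fin n → ℕ} → (∀ i → f i ≡ 0) → sum f ≡ 0
  sum-zero {zero} f≡0 = refl
  sum-zero {suc n} f≡0 = cong₂ _+_ (f≡0 Fin.zero) (sum-zero (f≡0 ∘ Fin.suc))

  ≤-sum : ∀ {n} (f : Fin n → ℕ) i → f i ≤ sum f
  ≤-sum f Fin.zero = m≤m+n _ _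
  ≤-sum f (Fin.suc i) = ≤-trans (≤-sum (f ∘ Fin.suc) i) (m≤n+m _ (f Fin.zero))

  sum-δ : ∀ {n} (v : Fin n) (f : Fin n → ℕ) → sum (λ i → [ i ==ᶠ v ] * f i) ≡ f v
  sum-δ {suc n} Fin.zero f =
    trans (cong (f Fin.zero + 0 +_) (sum-zero {n} (λ _ → refl))) (trans (+-identityʳ _) (+-identityʳ _))
  sum-δ {suc n} (Fin.suc v) f = sum-δ v (f ∘ Fin.suc)

  count : ∀ {n} → (Fin n → Bool) → ℕ
  count p = sum (λ i → [ p i ])

  countᵇ-tabulate : ∀ {A : Set} {n} (p : A → Bool) (f : Fin n → A) → countᵇ p (tabulate f) ≡ count (p ∘ f)
  countᵇ-tabulate {n = zero} p f = refl
  countᵇ-tabulate {n = suc n} p f with p (f Fin.zero)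
  ... | true = cong suc (countᵇ-tabulate p (f ∘ Fin.suc))
  ... | false = countᵇ-tabulate p (f ∘ Fin.suc)

  countᵇ-allFin : ∀ {n} (p : Fin n → Bool) → countᵇ p (allFin n) ≡ count p
  countᵇ-allFin p = countᵇ-tabulate p (λ i → i)

  count-cong : ∀ {n} {p q : Fin n → Bool} → (∀ i → p i ≡ q i) → count p ≡ count q
  count-cong p≗q = sum-cong-≗ (cong [_] ∘ p≗q)

  count-mono : ∀ {n} {p q : Fin n → Bool} → (∀ i → p i ≡ true → q i ≡ true) → count p ≤ count q
  count-mono p⊆q = sum-mono-≤ (λ i → []-mono (p⊆q i))

  count≤n : ∀ {n} (p : Fin n → Bool) → count p ≤ n
  count≤n {zero} p = z≤n
  count≤n {suc n} p = +-mono-≤ ([]≤1 (p Fin.zero)) (count≤n (p ∘ Fin.suc))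

  count-subadditive : ∀ {n} {p q r : Fin n → Bool} → (∀ i → p i ≡ true → q i ≡ true ⊎ r i ≡ true) →
    count p ≤ count q + count r
  count-subadditive {q = q} {r} p⊆q∪r =
    ≤-trans (sum-mono-≤ (λ i → []-subadditive (p⊆q∪r i))) (≤-reflexive (∑-distrib-+ (λ i → [ q i ]) (λ i → [ r i ])))

  count≤[] : ∀ {n} {p : Fin n → Bool} {b} → count p ≤ 1 → (∀ i → p i ≡ true → b ≡ true) → count p ≤ [ b ]
  count≤[] {b = true} ≤1 _ = ≤1
  count≤[] {p = p} {false} _ p⇒b = ≤-reflexive (sum-zero λ i → cong [_] (≢true⇒≡false λ pi → true≢false (p⇒b i pi) refl))

  count-permute : ∀ {n} (σ : Permutation′ n) (p : Fin n → Bool) → count (p ∘ (σ ⟨$⟩ʳ_)) ≡ count p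
  count-permute σ p = sym (∑-permute (λ i → [ p i ]) σ)

  count-==ᶠ : ∀ {n} (v : Fin n) → count (_==ᶠ v) ≡ 1
  count-==ᶠ v = trans (sum-cong-≗ (λ i → sym (*-identityʳ [ i ==ᶠ v ]))) (sum-δ v (λ _ → 1))

  count-strict-mono : ∀ {n} {p q : Fin n → Bool} → (∀ i → p i ≡ true → q i ≡ true) →
    ∀ v → q v ≡ true → p v ≡ false → suc (count p) ≤ count q
  count-strict-mono {p = p} {q} p⊆q Fin.zero qv pv rewrite qv | pv =
    s≤s (count-mono (p⊆q ∘ Fin.suc))
  count-strict-mono {p = p} {q} p⊆q (Fin.suc v) qv pv = begin
    suc ([ p Fin.zero ] + count (p ∘ Fin.suc)) ≡⟨ sym (+-suc _ _) ⟩
    [ p Fin.zero ] + suc (count (p ∘ Fin.suc)) ≤⟨ +-mono-≤ ([]-mono (p⊆q Fin.zero)) (count-strict-mono (p⊆q ∘ Fin.suc) v qv pv) ⟩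
    count q ∎
    where open ≤-Reasoning

  ∈⇒count>0 : ∀ {n} (p : Fin n → Bool) i → p i ≡ true → 1 ≤ count p
  ∈⇒count>0 p i pi = ≤-trans (≤-reflexive (cong [_] (sym pi))) (≤-sum (λ j → [ p j ]) i)

  count>0⇒∈ : ∀ {n} (p : Fin n → Bool) → 1 ≤ count p → ∃ λ i → p i ≡ true
  count>0⇒∈ {suc n} p h with p Fin.zero in e
  ... | true = Fin.zero , e
  ... | false = let i , pi = count>0⇒∈ (p ∘ Fin.suc) h in Fin.suc i , pi

  count≡0⇒∉ : ∀ {n} (p : Fin n → Bool) → count p ≡ 0 → ∀ i → p i ≡ false
  count≡0⇒∉ p h i with p i in e
  ... | false = refl
  ... | true = ⊥-elim (1+n≰n (≤-trans (∈⇒count>0 p i e) (≤-reflexive h)))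

  any-intro : ∀ {n} (p : Fin n → Bool) i → p i ≡ true → any p (allFin n) ≡ true
  any-intro p = go p (λ i → i)
    where
    go : ∀ {A : Set} {m} (p : A → Bool) (f : Fin m → A) i → p (f i) ≡ true → any p (tabulate f) ≡ true
    go p f Fin.zero pfi rewrite pfi = refl
    go p f (Fin.suc i) pfi = ∨-introʳ (p (f Fin.zero)) (go p (f ∘ Fin.suc) i pfi)

  any-elim : ∀ {n} (p : Fin n → Bool) → any p (allFin n) ≡ true → ∃ λ i → p i ≡ true
  any-elim p = go p (λ i → i)
    where
    go : ∀ {A : Set} {m} (p : A → Bool) (f : Fin m → A) → any p (tabulate f) ≡ true → ∃ λ i → p (f i) ≡ true
    go {m = suc m} p f h with ∨-elim {p (f Fin.zero)} h
    ... | inj₁ pf0 = Fin.zero , pf0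
    ... | inj₂ rest = let i , pfi = go p (f ∘ Fin.suc) rest in Fin.suc i , pfi

  any-false : ∀ {n} (p : Fin n → Bool) → (∀ i → p i ≡ false) → any p (allFin n) ≡ false
  any-false p none = ≢true⇒≡false (λ h → let i , pi = any-elim p h in true≢false pi (none i))

  any-cong : ∀ {n} {p q : Fin n → Bool} → (∀ i → p i ≡ q i) → any p (allFin n) ≡ any q (allFin n)
  any-cong {p = p} {q} p≗q = true-ext
    (λ h → let i , pi = any-elim p h in any-intro q i (trans (sym (p≗q i)) pi))
    (λ h → let i , qi = any-elim q h in any-intro p i (trans (p≗q i) qi))

  any-permute : ∀ {n} (σ : Permutation′ n) (p : Fin n → Bool) →
    any (p ∘ (σ ⟨$⟩ʳ_)) (allFin n) ≡ any p (allFin n)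
  any-permute σ p = true-ext
    (λ h → let i , pi = any-elim (p ∘ (σ ⟨$⟩ʳ_)) h in any-intro p (σ ⟨$⟩ʳ i) pi)
    (λ h → let i , pi = any-elim p h in
           any-intro (p ∘ (σ ⟨$⟩ʳ_)) (σ ⟨$⟩ˡ i) (trans (cong p (inverseʳ σ)) pi))

  ==ᶠ-refl : ∀ {n} (u : Fin n) → (u ==ᶠ u) ≡ true
  ==ᶠ-refl u = dec-true (u Fin.≟ u) refl

  ==ᶠ⇒≡ : ∀ {n} {u v : Fin n} → (u ==ᶠ v) ≡ true → u ≡ v
  ==ᶠ⇒≡ {u = u} {v} e with u Fin.≟ v
  ... | yes u≡v = u≡v

  ≢⇒==ᶠ-false : ∀ {n} {u v : Fin n} → ¬ u ≡ v → (u ==ᶠ v) ≡ false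
  ≢⇒==ᶠ-false {u = u} {v} = dec-false (u Fin.≟ v)

  count-≤1 : ∀ {n} (p : Fin n → Bool) → (∀ i j → p i ≡ true → p j ≡ true → i ≡ j) → count p ≤ 1
  count-≤1 {n} p unique with any p (allFin n) in e
  ... | true = let i , pi = any-elim p e in begin
    count p     ≤⟨ count-mono (λ j pj → subst (λ k → (j ==ᶠ k) ≡ true) (unique j i pj pi) (==ᶠ-refl j)) ⟩
    count (_==ᶠ i) ≡⟨ count-==ᶠ i ⟩
    1           ∎
    where open ≤-Reasoning
  ... | false = ≤-trans (≤-reflexive (sum-zero (λ i → cong [_] (none i)))) z≤n
    where
    none : ∀ i → p i ≡ false
    none i = ≢true⇒≡false (λ pi → true≢false (any-intro p i pi) e)

  _<ᶠ_ : ∀ {n} → Fin n → Fin n → Bool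
  i <ᶠ j = does (toℕ i <? toℕ j)

  <ᶠ⇒< : ∀ {n} {i j : Fin n} → (i <ᶠ j) ≡ true → toℕ i < toℕ j
  <ᶠ⇒< {i = i} {j} i<j = <ᵇ⇒< (toℕ i) (toℕ j) (Equivalence.from T-≡ i<j)

  <⇒<ᶠ : ∀ {n} {i j : Fin n} → toℕ i < toℕ j → (i <ᶠ j) ≡ true
  <⇒<ᶠ {i = i} {j} = dec-true (toℕ i <? toℕ j)

  countArcs : ∀ {n} → Adj n → ℕ
  countArcs R = sum (λ i → sum (λ j → [ R i j ]))

  countPairs : ∀ {n} → Adj n → ℕ
  countPairs R = sum (λ i → sum (λ j → [ i <ᶠ j ∧ R i j ]))

  Symmetric : ∀ {n} → Adj n → Set
  Symmetric R = ∀ i j → R i j ≡ R j i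

  Irreflexive : ∀ {n} → Adj n → Set
  Irreflexive R = ∀ i → R i i ≡ false

  module _ {A : Set} where

    countᵇ-++ : (p : A → Bool) (xs ys : List A) → countᵇ p (xs ++ ys) ≡ countᵇ p xs + countᵇ p ys
    countᵇ-++ p [] ys = refl
    countᵇ-++ p (x ∷ xs) ys with p x
    ... | true = cong suc (countᵇ-++ p xs ys)
    ... | false = countᵇ-++ p xs ys

    countᵇ-map : ∀ {B : Set} (p : B → Bool) (f : A → B) xs → countᵇ p (map f xs) ≡ countᵇ (p ∘ f) xs
    countᵇ-map p f [] = refl
    countᵇ-map p f (x ∷ xs) with p (f x)
    ... | true = cong suc (countᵇ-map p f xs)
    ... | false = countᵇ-map p f xs

    countᵇ-filter : ∀ {P : A → Set} (P? : ∀ x → Dec (P x)) (p : A → Bool) xs →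
      countᵇ p (filter P? xs) ≡ countᵇ (λ x → does (P? x) ∧ p x) xs
    countᵇ-filter P? p [] = refl
    countᵇ-filter P? p (x ∷ xs) with does (P? x)
    ... | false = countᵇ-filter P? p xs
    ... | true with p x
    ... | true = cong suc (countᵇ-filter P? p xs)
    ... | false = countᵇ-filter P? p xs

  countᵇ-concatMap-allFin : ∀ {B : Set} {n} (p : B → Bool) (f : Fin n → List B) →
    countᵇ p (concatMap f (allFin n)) ≡ sum (λ i → countᵇ p (f i))
  countᵇ-concatMap-allFin p f = go (λ i → i)
    where
    go : ∀ {m} (g : Fin m → _) → countᵇ p (concatMap f (tabulate g)) ≡ sum (λ i → countᵇ p (f (g i)))
    go {zero} g = refl
    go {suc m} g = trans (countᵇ-++ p (f (g Fin.zero)) _) (cong (countᵇ p (f (g Fin.zero)) +_) (go (g ∘ Fin.suc)))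

  countᵇ-pairs : ∀ {n} (R : Adj n) → countᵇ (λ { (i , j) → R i j }) (pairs n) ≡ countPairs R
  countᵇ-pairs {n} R = trans (countᵇ-concatMap-allFin R̃ row) (sum-cong-≗ λ i →
    trans (countᵇ-map R̃ (i ,_) (filter (λ j → toℕ i <? toℕ j) (allFin n))) (trans (countᵇ-filter (λ j → toℕ i <? toℕ j) (R i) (allFin n))
          (countᵇ-allFin (λ j → i <ᶠ j ∧ R i j))))
    where
    R̃ : Fin n × Fin n → Bool
    R̃ (i , j) = R i j
    row : Fin n → List (Fin n × Fin n)
    row i = map (i ,_) (filter (λ j → toℕ i <? toℕ j) (allFin n))

  editCount≡countPairs : ∀ {n} (G H : Adj n) (σ : Permutation′ n) →
    editCount G H σ ≡ countPairs (λ i j → xor (G i j) (H (σ ⟨$⟩ʳ i) (σ ⟨$⟩ʳ j)))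
  editCount≡countPairs G H σ = countᵇ-pairs (λ i j → xor (G i j) (H (σ ⟨$⟩ʳ i) (σ ⟨$⟩ʳ j)))

  []-split-<ᶠ : ∀ {n} {R : Adj n} → Irreflexive R → ∀ i j →
    [ R i j ] ≡ [ i <ᶠ j ∧ R i j ] + [ j <ᶠ i ∧ R i j ]
  []-split-<ᶠ {R = R} irr i j with <-cmp (toℕ i) (toℕ j)
  ... | tri< i<j _ _ rewrite dec-true (toℕ i <? toℕ j) i<j | dec-false (toℕ j <? toℕ i) (<-asym i<j) =
    sym (+-identityʳ _)
  ... | tri> i≮j _ j<i rewrite dec-false (toℕ i <? toℕ j) i≮j | dec-true (toℕ j <? toℕ i) j<i = refl
  ... | tri≈ _ i≡j _ rewrite toℕ-injective i≡j | irr j | ∧-zeroʳ (j <ᶠ j) = refl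

  countArcs≡countPairs+countPairs : ∀ {n} {R : Adj n} → Symmetric R → Irreflexive R →
    countArcs R ≡ countPairs R + countPairs R
  countArcs≡countPairs+countPairs {R = R} sym-R irr-R = begin
    countArcs R
      ≡⟨ sum-cong-≗ (λ i → trans (sum-cong-≗ ([]-split-<ᶠ irr-R i)) (∑-distrib-+ (below i) (above i))) ⟩
    sum (λ i → sum (below i) + sum (above i))
      ≡⟨ ∑-distrib-+ (sum ∘ below) (sum ∘ above) ⟩
    countPairs R + sum (λ i → sum (above i))
      ≡⟨ cong (countPairs R +_) (trans (∑-comm above) (sum-cong-≗ λ j → sum-cong-≗ λ i →
           cong (λ b → [ j <ᶠ i ∧ b ]) (sym-R i j))) ⟩
    countPairs R + countPairs R ∎
    where
    open ≡-Reasoning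
    below above : _ → _ → ℕ
    below i j = [ i <ᶠ j ∧ R i j ]
    above i j = [ j <ᶠ i ∧ R i j ]

  +-self-injective : ∀ {a b} → a + a ≡ b + b → a ≡ b
  +-self-injective {a} {b} e with <-cmp a b
  ... | tri≈ _ a≡b _ = a≡b
  ... | tri< a<b _ _ = ⊥-elim (<-irrefl e (+-mono-< a<b a<b))
  ... | tri> _ _ b<a = ⊥-elim (<-irrefl (sym e) (+-mono-< b<a b<a))

  countPairs-permute : ∀ {n} (σ : Permutation′ n) {R : Adj n} → Symmetric R → Irreflexive R →
    countPairs (λ i j → R (σ ⟨$⟩ʳ i) (σ ⟨$⟩ʳ j)) ≡ countPairs R
  countPairs-permute σ {R} sym-R irr-R = +-self-injective (begin
    countPairs Rσ + countPairs Rσ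
      ≡⟨ sym (countArcs≡countPairs+countPairs (λ i j → sym-R (σ ⟨$⟩ʳ i) (σ ⟨$⟩ʳ j)) (irr-R ∘ (σ ⟨$⟩ʳ_))) ⟩
    countArcs Rσ
      ≡⟨ sum-cong-≗ (λ i → count-permute σ (R (σ ⟨$⟩ʳ i))) ⟩
    sum (λ i → count (R (σ ⟨$⟩ʳ i)))
      ≡⟨ sym (∑-permute (count ∘ R) σ) ⟩
    countArcs R
      ≡⟨ countArcs≡countPairs+countPairs sym-R irr-R ⟩
    countPairs R + countPairs R ∎)
    where
    open ≡-Reasoning
    Rσ : Adj _
    Rσ i j = R (σ ⟨$⟩ʳ i) (σ ⟨$⟩ʳ j)

  countPairs-subadditive : ∀ {n} {R S T : Adj n} → (∀ i j → R i j ≡ true → S i j ≡ true ⊎ T i j ≡ true) →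
    countPairs R ≤ countPairs S + countPairs T
  countPairs-subadditive {R = R} {S} {T} R⊆S∪T = begin
    countPairs R
      ≤⟨ sum-mono-≤ (λ i → sum-mono-≤ (λ j → [∧]-subadditive (i <ᶠ j) (R⊆S∪T i j))) ⟩
    sum (λ i → sum (λ j → [ i <ᶠ j ∧ S i j ] + [ i <ᶠ j ∧ T i j ]))
      ≡⟨ sum-cong-≗ (λ i → ∑-distrib-+ (λ j → [ i <ᶠ j ∧ S i j ]) (λ j → [ i <ᶠ j ∧ T i j ])) ⟩
    sum (λ i → sum (λ j → [ i <ᶠ j ∧ S i j ]) + sum (λ j → [ i <ᶠ j ∧ T i j ]))
      ≡⟨ ∑-distrib-+ (λ i → sum (λ j → [ i <ᶠ j ∧ S i j ])) (λ i → sum (λ j → [ i <ᶠ j ∧ T i j ])) ⟩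
    countPairs S + countPairs T ∎
    where open ≤-Reasoning

  countPairs-empty : ∀ {n} {R : Adj n} → (∀ i j → R i j ≡ false) → countPairs R ≡ 0
  countPairs-empty {R = R} R≡∅ = sum-zero λ i → sum-zero λ j →
    cong [_] (trans (cong (i <ᶠ j ∧_) (R≡∅ i j)) (∧-zeroʳ (i <ᶠ j)))

  xor-triangle : ∀ a b c → xor a c ≡ true → xor a b ≡ true ⊎ xor b c ≡ true
  xor-triangle false false c ac = inj₂ ac
  xor-triangle false true c ac = inj₁ refl
  xor-triangle true false c ac = inj₁ refl
  xor-triangle true true c ac = inj₂ ac

  xor-comm : ∀ a b → xor a b ≡ xor b a
  xor-comm false false = refl
  xor-comm false true = refl
  xor-comm true false = refl
  xor-comm true true = refl

  xor-self : ∀ a → xor a a ≡ false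
  xor-self false = refl
  xor-self true = refl

  xor≡false⇒≡ : ∀ {a b} → xor a b ≡ false → a ≡ b
  xor≡false⇒≡ {false} {false} _ = refl
  xor≡false⇒≡ {true} {true} _ = refl

  diffPairs : ∀ {n} → Adj n → Adj n → ℕ
  diffPairs G G' = countPairs (λ i j → xor (G i j) (G' i j))

  module _ {n} {G G' H H' : Adj n} (sym-H : Symmetric H) (irr-H : Irreflexive H)
           (sym-H' : Symmetric H') (irr-H' : Irreflexive H') where

    editCount-triangle : ∀ σ → editCount G H σ ≤ diffPairs G G' + editCount G' H' σ + diffPairs H H'
    editCount-triangle σ = begin
      editCount G H σ
        ≡⟨ editCount≡countPairs G H σ ⟩
      countPairs (λ i j → xor (G i j) (Hσ i j))
        ≤⟨ countPairs-subadditive (λ i j → xor-triangle (G i j) (G' i j) (Hσ i j)) ⟩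
      diffPairs G G' + countPairs (λ i j → xor (G' i j) (Hσ i j))
        ≤⟨ +-monoʳ-≤ (diffPairs G G') (countPairs-subadditive (λ i j → xor-triangle (G' i j) (H'σ i j) (Hσ i j))) ⟩
      diffPairs G G' + (countPairs (λ i j → xor (G' i j) (H'σ i j)) + countPairs (λ i j → xor (H'σ i j) (Hσ i j)))
        ≡⟨ sym (+-assoc (diffPairs G G') _ _) ⟩
      diffPairs G G' + countPairs (λ i j → xor (G' i j) (H'σ i j)) + countPairs (λ i j → xor (H'σ i j) (Hσ i j))
        ≡⟨ cong₂ (λ a b → diffPairs G G' + a + b) (sym (editCount≡countPairs G' H' σ)) H'H-permuted ⟩
      diffPairs G G' + editCount G' H' σ + diffPairs H H' ∎
      where
      open ≤-Reasoning
      Hσ H'σ : Adj n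
      Hσ i j = H (σ ⟨$⟩ʳ i) (σ ⟨$⟩ʳ j)
      H'σ i j = H' (σ ⟨$⟩ʳ i) (σ ⟨$⟩ʳ j)
      H'H-permuted : countPairs (λ i j → xor (H'σ i j) (Hσ i j)) ≡ diffPairs H H'
      H'H-permuted = trans
        (countPairs-permute σ (λ i j → cong₂ xor (sym-H' i j) (sym-H i j)) (λ i → cong₂ xor (irr-H' i) (irr-H i)))
        (sum-cong-≗ λ i → sum-cong-≗ λ j → cong (λ b → [ i <ᶠ j ∧ b ]) (xor-comm (H' i j) (H i j)))

    dist-triangle : ∀ {d d'} → IsDist G H d → IsDist G' H' d' → d ≤ diffPairs G G' + d' + diffPairs H H'
    dist-triangle (_ , minimal) ((σ , d'≡) , _) = begin
      _ ≤⟨ minimal σ ⟩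
      editCount G H σ ≤⟨ editCount-triangle σ ⟩
      diffPairs G G' + editCount G' H' σ + diffPairs H H' ≡⟨ cong (λ t → diffPairs G G' + t + diffPairs H H') d'≡ ⟩
      _ ∎
      where open ≤-Reasoning

  countPairs≡0⇒ : ∀ {n} {R : Adj n} → countPairs R ≡ 0 → ∀ i j → toℕ i < toℕ j → R i j ≡ false
  countPairs≡0⇒ {R = R} R≡0 i j i<j = ≢true⇒≡false λ Rij → 1+n≰n (begin
    1                                  ≡⟨ cong [_] (sym (∧-intro (dec-true (toℕ i <? toℕ j) i<j) Rij)) ⟩
    [ i <ᶠ j ∧ R i j ]                 ≤⟨ ≤-sum (λ j → [ i <ᶠ j ∧ R i j ]) j ⟩
    sum (λ j → [ i <ᶠ j ∧ R i j ])     ≤⟨ ≤-sum (λ i → sum (λ j → [ i <ᶠ j ∧ R i j ])) i ⟩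
    countPairs R                       ≡⟨ R≡0 ⟩
    0                                  ∎)
    where open ≤-Reasoning

  editCount≡0⇒isomorphism : ∀ {n} {G H : Adj n} → Symmetric G → Irreflexive G → Symmetric H → Irreflexive H →
    ∀ σ → editCount G H σ ≡ 0 → ∀ i j → G i j ≡ H (σ ⟨$⟩ʳ i) (σ ⟨$⟩ʳ j)
  editCount≡0⇒isomorphism {G = G} {H} sym-G irr-G sym-H irr-H σ e≡0 = agree
    where
    agree< : ∀ i j → toℕ i < toℕ j → G i j ≡ H (σ ⟨$⟩ʳ i) (σ ⟨$⟩ʳ j)
    agree< = λ i j i<j → xor≡false⇒≡ (countPairs≡0⇒ (trans (sym (editCount≡countPairs G H σ)) e≡0) i j i<j)
    agree : ∀ i j → G i j ≡ H (σ ⟨$⟩ʳ i) (σ ⟨$⟩ʳ j)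
    agree i j with <-cmp (toℕ i) (toℕ j)
    ... | tri< i<j _ _ = agree< i j i<j
    ... | tri> _ _ j<i = trans (sym-G i j) (trans (agree< j i j<i) (sym-H _ _))
    ... | tri≈ _ i≡j _ rewrite toℕ-injective i≡j = trans (irr-G j) (sym (irr-H _))

  isomorphism⇒editCount≡0 : ∀ {n} {G H : Adj n} σ → (∀ i j → G i j ≡ H (σ ⟨$⟩ʳ i) (σ ⟨$⟩ʳ j)) → editCount G H σ ≡ 0
  isomorphism⇒editCount≡0 {G = G} {H} σ iso = trans (editCount≡countPairs G H σ)
    (countPairs-empty λ i j → trans (cong (λ b → xor b _) (iso i j)) (xor-self (H (σ ⟨$⟩ʳ i) (σ ⟨$⟩ʳ j))))


  keepᵇ : Bool → Bool → Bool → Bool → Bool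
  keepᵇ hu hv ku kv = if hu then (if hv then false else kv) else (if hv then ku else true)

  keepᵇ-sym : ∀ hu hv ku kv → keepᵇ hu hv ku kv ≡ keepᵇ hv hu kv ku
  keepᵇ-sym true true _ _ = refl
  keepᵇ-sym true false _ _ = refl
  keepᵇ-sym false true _ _ = refl
  keepᵇ-sym false false _ _ = refl

  -- Defs.Partition for arbitrary high-degree and large-component tests; Partition-G'≡Construction-G'
  -- below identifies the two.
  module Construction {n} (isHigh isLarge : ℕ → Bool) (G : Adj n) where

    deg : Fin n → ℕ
    deg v = countᵇ (G v) (allFin n)

    high : Fin n → Bool
    high v = isHigh (deg v)

    low : Fin n → Bool
    low v = not (high v)

    reach : ℕ → Fin n → Fin n → Bool
    reach zero    u v = low u ∧ (u ==ᶠ v)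
    reach (suc k) u v = reach k u v ∨ any (λ w → reach k u w ∧ G w v ∧ low v) (allFin n)

    sameComp : Fin n → Fin n → Bool
    sameComp u v = reach n u v

    compSize : Fin n → ℕ
    compSize u = countᵇ (sameComp u) (allFin n)

    large : Fin n → Bool
    large u = isLarge (compSize u)

    highNbrs : Fin n → ℕ
    highNbrs u = countᵇ (λ h → high h ∧ any (λ v → sameComp u v ∧ G v h) (allFin n)) (allFin n)

    keepLH : Fin n → Bool
    keepLH l = not (large l) ∧ (highNbrs l <ᵇ 2)

    keep : Fin n → Fin n → Bool
    keep u v = keepᵇ (high u) (high v) (keepLH u) (keepLH v)

    G' : Adj n
    G' u v = G u v ∧ keep u v

  module Reachability {n} (isHigh isLarge : ℕ → Bool) (G : Adj n) (sym-G : Symmetric G) where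
    open Construction isHigh isLarge G

    reach-last-step : ∀ k u v → any (λ w → reach k u w ∧ G w v ∧ low v) (allFin n) ≡ true →
      ∃ λ w → reach k u w ≡ true × G w v ≡ true
    reach-last-step k u v h = let w , rw = any-elim (λ w → reach k u w ∧ G w v ∧ low v) h in
      w , ∧-elimˡ rw , ∧-elimˡ (∧-elimʳ {reach k u w} rw)

    reach⇒lowˡ : ∀ k u v → reach k u v ≡ true → low u ≡ true
    reach⇒lowˡ zero u v r = ∧-elimˡ r
    reach⇒lowˡ (suc k) u v r with ∨-elim {reach k u v} r
    ... | inj₁ r' = reach⇒lowˡ k u v r'
    ... | inj₂ r' = let w , rw , _ = reach-last-step k u v r' in reach⇒lowˡ k u w rw

    reach⇒lowʳ : ∀ k u v → reach k u v ≡ true → low v ≡ true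
    reach⇒lowʳ zero u v r = subst (λ x → low x ≡ true) (==ᶠ⇒≡ {u = u} {v} (∧-elimʳ {low u} r)) (∧-elimˡ r)
    reach⇒lowʳ (suc k) u v r with ∨-elim {reach k u v} r
    ... | inj₁ r' = reach⇒lowʳ k u v r'
    ... | inj₂ r' = let w , rw = any-elim (λ w → reach k u w ∧ G w v ∧ low v) r' in
      ∧-elimʳ {G w v} (∧-elimʳ {reach k u w} rw)

    reach-suc : ∀ k u v → reach k u v ≡ true → reach (suc k) u v ≡ true
    reach-suc k u v r = ∨-introˡ (any (λ w → reach k u w ∧ G w v ∧ low v) (allFin n)) r

    reach-mono : ∀ {k m} u v → k ≤ m → reach k u v ≡ true → reach m u v ≡ true
    reach-mono {k} u v k≤m r with m≤n⇒∃[o]m+o≡n k≤m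
    ... | o , refl = go o
      where
      go : ∀ o → reach (k + o) u v ≡ true
      go zero rewrite +-identityʳ k = r
      go (suc o) rewrite +-suc k o = reach-suc (k + o) u v (go o)

    reach-refl : ∀ u → low u ≡ true → reach 0 u u ≡ true
    reach-refl u lu = ∧-intro lu (==ᶠ-refl u)

    reach-snoc : ∀ k u w v → reach k u w ≡ true → G w v ≡ true → low v ≡ true → reach (suc k) u v ≡ true
    reach-snoc k u w v r e lv =
      ∨-introʳ (reach k u v) (any-intro (λ x → reach k u x ∧ G x v ∧ low v) w (∧-intro r (∧-intro e lv)))

    reach-cons : ∀ k u w v → low u ≡ true → G u w ≡ true → reach k w v ≡ true → reach (suc k) u v ≡ true
    reach-cons zero u w v lu e r with ==ᶠ⇒≡ {u = w} {v} (∧-elimʳ {low w} r)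
    ... | refl = reach-snoc 0 u u w (reach-refl u lu) e (∧-elimˡ r)
    reach-cons (suc k) u w v lu e r with ∨-elim {reach k w v} r
    ... | inj₁ r' = reach-suc (suc k) u v (reach-cons k u w v lu e r')
    ... | inj₂ r' = let x , rx , ex = reach-last-step k w v r' in
      reach-snoc (suc k) u x v (reach-cons k u w x lu e rx) ex (reach⇒lowʳ (suc k) w v r)

    reach-sym : ∀ k u v → reach k u v ≡ true → reach k v u ≡ true
    reach-sym zero u v r with ==ᶠ⇒≡ {u = u} {v} (∧-elimʳ {low u} r)
    ... | refl = r
    reach-sym (suc k) u v r with ∨-elim {reach k u v} r
    ... | inj₁ r' = reach-suc k v u (reach-sym k u v r')
    ... | inj₂ r' = let w , rw , ew = reach-last-step k u v r' in
      reach-cons k v w u (reach⇒lowʳ (suc k) u v r) (trans (sym-G v w) ew) (reach-sym k u w rw)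

    reach-trans : ∀ k m u w v → reach k u w ≡ true → reach m w v ≡ true → reach (k + m) u v ≡ true
    reach-trans k zero u w v r₁ r₂ with ==ᶠ⇒≡ {u = w} {v} (∧-elimʳ {low w} r₂)
    ... | refl = subst (λ t → reach t u w ≡ true) (sym (+-identityʳ k)) r₁
    reach-trans k (suc m) u w v r₁ r₂ rewrite +-suc k m with ∨-elim {reach m w v} r₂
    ... | inj₁ r' = reach-suc (k + m) u v (reach-trans k m u w v r₁ r')
    ... | inj₂ r' = let x , rx , ex = reach-last-step m w v r' in
      reach-snoc (k + m) u x v (reach-trans k m u w x r₁ rx) ex (reach⇒lowʳ (suc m) w v r₂)

    Stable : ℕ → Fin n → Set
    Stable j u = ∀ v → reach (suc j) u v ≡ reach j u v

    stable-suc : ∀ j u → Stable j u → Stable (suc j) u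
    stable-suc j u st v = begin
      reach (suc j) u v ∨ any (λ w → reach (suc j) u w ∧ G w v ∧ low v) (allFin n)
        ≡⟨ cong (reach (suc j) u v ∨_) (any-cong (λ w → cong (λ b → b ∧ G w v ∧ low v) (st w))) ⟩
      (reach j u v ∨ step) ∨ step  ≡⟨ ∨-assoc (reach j u v) step step ⟩
      reach j u v ∨ (step ∨ step)  ≡⟨ cong (reach j u v ∨_) (∨-idem step) ⟩
      reach (suc j) u v            ∎
      where
      open ≡-Reasoning
      step : Bool
      step = any (λ w → reach j u w ∧ G w v ∧ low v) (allFin n)

    stable-+ : ∀ j u → Stable j u → ∀ m v → reach (m + j) u v ≡ reach j u v
    stable-+ j u st zero v = refl
    stable-+ j u st (suc m) v = trans (stable-from m v) (stable-+ j u st m v)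
      where
      stable-from : ∀ m → Stable (m + j) u
      stable-from zero = st
      stable-from (suc m) = stable-suc (m + j) u (stable-from m)

    newlyReached : ℕ → Fin n → Fin n → Bool
    newlyReached j u v = reach (suc j) u v ∧ not (reach j u v)

    stable-or-grows : ∀ j u → Stable j u ⊎ ∃ λ v → reach (suc j) u v ≡ true × reach j u v ≡ false
    stable-or-grows j u with any (newlyReached j u) (allFin n) in e
    ... | true = let v , newv = any-elim (newlyReached j u) e in
      inj₂ (v , ∧-elimˡ newv , not≡true⇒≡false (∧-elimʳ {reach (suc j) u v} newv))
    ... | false = inj₁ λ v → true-ext (old v) (reach-suc j u v)
      where
      old : ∀ v → reach (suc j) u v ≡ true → reach j u v ≡ true
      old v r = ≢false⇒≡true λ ej →
        true≢false (any-intro (newlyReached j u) v (∧-intro {reach (suc j) u v} r (≡false⇒not≡true ej))) e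

    stabilises : ∀ u → low u ≡ true → ∀ j → (∃ λ i → i ≤ j × Stable i u) ⊎ j < count (reach j u)
    stabilises u lu zero = inj₂ (∈⇒count>0 (reach 0 u) u (reach-refl u lu))
    stabilises u lu (suc j) with stabilises u lu j
    ... | inj₁ (i , i≤j , st) = inj₁ (i , m≤n⇒m≤1+n i≤j , st)
    ... | inj₂ grown with stable-or-grows j u
    ... | inj₁ st = inj₁ (j , n≤1+n j , st)
    ... | inj₂ (v , new , old) = inj₂ (≤-trans (s≤s grown) (count-strict-mono (reach-suc j u) v new old))

    reach⇒sameComp : ∀ k u v → reach k u v ≡ true → sameComp u v ≡ true
    reach⇒sameComp k u v r with k ≤? n
    ... | yes k≤n = reach-mono {k} {n} u v k≤n r
    ... | no k≰n with stabilises u (reach⇒lowˡ k u v r) n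
    ... | inj₂ n<count = ⊥-elim (<⇒≱ n<count (count≤n (reach n u)))
    ... | inj₁ (i , i≤n , st) = begin
      reach n u v ≡⟨ reach-from-stable i≤n ⟩
      reach i u v ≡⟨ reach-from-stable (≤-trans i≤n (<⇒≤ (≰⇒> k≰n))) ⟨
      reach k u v ≡⟨ r ⟩
      true        ∎
      where
      open ≡-Reasoning
      reach-from-stable : ∀ {m} → i ≤ m → reach m u v ≡ reach i u v
      reach-from-stable i≤m = let a , i+a≡m = m≤n⇒∃[o]m+o≡n i≤m in
        trans (cong (λ t → reach t u v) (trans (sym i+a≡m) (+-comm i a))) (stable-+ i u st a v)
    sameComp-refl : ∀ u → low u ≡ true → sameComp u u ≡ true
    sameComp-refl u lu = reach-mono {0} {n} u u z≤n (reach-refl u lu)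

    sameComp-sym : ∀ u v → sameComp u v ≡ true → sameComp v u ≡ true
    sameComp-sym = reach-sym n

    sameComp-trans : ∀ u w v → sameComp u w ≡ true → sameComp w v ≡ true → sameComp u v ≡ true
    sameComp-trans u w v c₁ c₂ = reach⇒sameComp (n + n) u v (reach-trans n n u w v c₁ c₂)

    sameComp⇒lowʳ : ∀ u v → sameComp u v ≡ true → low v ≡ true
    sameComp⇒lowʳ = reach⇒lowʳ n

    sameComp-congˡ : ∀ u v → sameComp u v ≡ true → ∀ w → sameComp u w ≡ sameComp v w
    sameComp-congˡ u v c w = true-ext (sameComp-trans v u w (sameComp-sym u v c)) (sameComp-trans u v w c)

    compSize-congˡ : ∀ u v → sameComp u v ≡ true → compSize u ≡ compSize v
    compSize-congˡ u v c = trans (countᵇ-allFin (sameComp u))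
      (trans (count-cong (sameComp-congˡ u v c)) (sym (countᵇ-allFin (sameComp v))))

    highNbrs-congˡ : ∀ u v → sameComp u v ≡ true → highNbrs u ≡ highNbrs v
    highNbrs-congˡ u v c = trans (countᵇ-allFin (λ h → high h ∧ any (λ w → sameComp u w ∧ G w h) (allFin n))) (trans
      (count-cong λ h → cong (high h ∧_) (any-cong λ w → cong (_∧ G w h) (sameComp-congˡ u v c w)))
      (sym (countᵇ-allFin (λ h → high h ∧ any (λ w → sameComp v w ∧ G w h) (allFin n)))))

    keepLH-congˡ : ∀ u v → sameComp u v ≡ true → keepLH u ≡ keepLH v
    keepLH-congˡ u v c rewrite compSize-congˡ u v c | highNbrs-congˡ u v c = refl

  all≢⇒any==false : ∀ {n} {x : Fin n} {xs} → All (λ y → ¬ x ≡ y) xs → any (x ==ᶠ_) xs ≡ false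
  all≢⇒any==false [] = refl
  all≢⇒any==false (x≢y ∷ x∉ys) rewrite ≢⇒==ᶠ-false x≢y = all≢⇒any==false x∉ys

  Unique-length≤ : ∀ {n} (xs : List (Fin n)) → Unique xs → length xs ≤ n
  Unique-length≤ {n} xs u = ≤-trans (≤-reflexive (length≡count xs u)) (count≤n _)
    where
    length≡count : ∀ xs → Unique xs → length xs ≡ count (λ v → any (v ==ᶠ_) xs)
    length≡count [] _ = sym (sum-zero {n} (λ _ → refl))
    length≡count (x ∷ xs) (x∉xs ∷ u) = begin
      suc (length xs)                                       ≡⟨ cong suc (length≡count xs u) ⟩
      suc (count (λ v → any (v ==ᶠ_) xs))                    ≡⟨ cong (_+ _) (count-==ᶠ x) ⟨
      count (_==ᶠ x) + count (λ v → any (v ==ᶠ_) xs)          ≡⟨ ∑-distrib-+ (λ v → [ v ==ᶠ x ]) (λ v → [ any (v ==ᶠ_) xs ]) ⟨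
      sum (λ v → [ v ==ᶠ x ] + [ any (v ==ᶠ_) xs ])           ≡⟨ sum-cong-≗ disjoint ⟩
      count (λ v → any (v ==ᶠ_) (x ∷ xs))                    ∎
      where
      open ≡-Reasoning
      x∉ : any (x ==ᶠ_) xs ≡ false
      x∉ = all≢⇒any==false x∉xs
      disjoint : ∀ v → [ v ==ᶠ x ] + [ any (v ==ᶠ_) xs ] ≡ [ (v ==ᶠ x) ∨ any (v ==ᶠ_) xs ]
      disjoint v with v Fin.≟ x
      ... | yes refl rewrite x∉ = refl
      ... | no _ = refl

  count≥2⇒∃≢ : ∀ {n} (p : Fin n → Bool) → 2 ≤ count p → ∀ u → ∃ λ b → p b ≡ true × ¬ b ≡ u
  count≥2⇒∃≢ {n} p h u with any (λ b → p b ∧ not (b ==ᶠ u)) (allFin n) in e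
  ... | true = let b , pb = any-elim (λ b → p b ∧ not (b ==ᶠ u)) e in
    b , ∧-elimˡ pb , λ b≡u →
      true≢false (==ᶠ-refl u) (not≡true⇒≡false (subst (λ w → not (w ==ᶠ u) ≡ true) b≡u (∧-elimʳ {p b} pb)))
  ... | false = ⊥-elim (<⇒≱ h (count-≤1 p only-u))
    where
    ≡u : ∀ b → p b ≡ true → b ≡ u
    ≡u b pb = ==ᶠ⇒≡ (≢false⇒≡true λ b≠u →
      true≢false (any-intro (λ b → p b ∧ not (b ==ᶠ u)) b (∧-intro pb (≡false⇒not≡true b≠u))) e)
    only-u : ∀ i j → p i ≡ true → p j ≡ true → i ≡ j
    only-u i j pi pj = trans (≡u i pi) (sym (≡u j pj))

  Unique-prefix : ∀ {A : Set} (xs : List A) {b post} → Unique (xs ++ b ∷ post) → Unique (xs ++ b ∷ [])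
  Unique-prefix [] (_ ∷ _) = [] ∷ []
  Unique-prefix (x ∷ xs) (x∉ ∷ u) = All-prefix xs x∉ ∷ Unique-prefix xs u
    where
    All-prefix : ∀ {A : Set} {P : A → Set} (xs : List A) {b post} → All P (xs ++ b ∷ post) → All P (xs ++ b ∷ [])
    All-prefix [] (pb ∷ _) = pb ∷ []
    All-prefix (x ∷ xs) (px ∷ pxs) = px ∷ All-prefix xs pxs

  module Forest {n} (G : Adj n) (sym-G : Symmetric G) (irr-G : Irreflexive G)
                (acyclic : ∀ c → ¬ IsCycle G c) where
    open import Data.List.Membership.DecPropositional (Fin._≟_ {n}) using (_∈?_)

    IsPath : List (Fin n) → Set
    IsPath [] = ⊤
    IsPath (x ∷ []) = ⊤
    IsPath (x ∷ y ∷ xs) = G x y ≡ true × IsPath (y ∷ xs)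

    path-closes : ∀ {b f post} z zs → IsPath (z ∷ zs ++ b ∷ post) → G b f ≡ true → consecAdj G f (z ∷ zs ++ b ∷ [])
    path-closes z [] (e , _) e' = e , e'
    path-closes z (w ∷ ws) (e , p) e' = e , path-closes w ws p e'

    edgeIn : (Fin n → Bool) → Adj n
    edgeIn S a b = S a ∧ S b ∧ G a b

    edgeIn-sym : ∀ S → Symmetric (edgeIn S)
    edgeIn-sym S a b with S a | S b
    ... | true | true = sym-G a b
    ... | true | false = refl
    ... | false | true = refl
    ... | false | false = refl

    arcsIn : (Fin n → Bool) → ℕ
    arcsIn S = countArcs (edgeIn S)

    degIn : (Fin n → Bool) → Fin n → ℕ
    degIn S v = count (λ b → S b ∧ G v b)

    -- A walk inside S that never turns back (kept newest vertex first) cannot close up, so it runs out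
    -- of fresh vertices.
    minDegree≥2⇒empty : (S : Fin n → Bool) → (∀ v → S v ≡ true → 2 ≤ degIn S v) → ∀ v → S v ≡ true → ⊥
    minDegree≥2⇒empty S deg≥2 v Sv = walk n v [] Sv ([] ∷ []) tt refl
      where
      walk : ∀ fuel x rest → S x ≡ true → Unique (x ∷ rest) → IsPath (x ∷ rest) → length rest + fuel ≡ n → ⊥
      walk zero x rest _ u _ e =
        1+n≰n (≤-trans (≤-reflexive (cong suc (sym (trans (sym (+-identityʳ (length rest))) e)))) (Unique-length≤ (x ∷ rest) u))
      walk (suc f) x rest Sx u p e with count≥2⇒∃≢ (λ b → S b ∧ G x b) (deg≥2 x Sx) (previous rest)
        where
        previous : List (Fin n) → Fin n
        previous [] = x
        previous (y ∷ _) = y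
      ... | b , Sb∧xb , b≢prev with b ∈? (x ∷ rest)
      ... | no b∉ = walk f b (x ∷ rest) (∧-elimˡ Sb∧xb) (¬Any⇒All¬ (x ∷ rest) b∉ ∷ u)
                      (trans (sym-G b x) (∧-elimʳ {S b} Sb∧xb) , p) (trans (sym (+-suc (length rest) f)) e)
      ... | yes (here refl) = true≢false (∧-elimʳ {S b} Sb∧xb) (irr-G b)
      walk (suc f) x [] Sx u p e | b , _ , _ | yes (there ())
      walk (suc f) x (y ∷ rest) Sx u p e | b , _ , b≢y | yes (there (here refl)) = b≢y refl
      walk (suc f) x (y ∷ rest) Sx u p e | b , Sb∧xb , _ | yes (there (there b∈rest)) with ∈-∃++ b∈rest
      ... | pre , post , refl = acyclic (x ∷ y ∷ pre ++ b ∷ [])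
        ( s≤s (subst (1 ≤_) (sym (trans (length-++ pre) (+-comm (length pre) 1))) (s≤s z≤n))
        , Unique-prefix (x ∷ y ∷ pre) u
        , path-closes x (y ∷ pre) p (trans (sym-G b x) (∧-elimʳ {S b} Sb∧xb)))

    _-ᵛ_ : (Fin n → Bool) → Fin n → Fin n → Bool
    (S -ᵛ v) a = S a ∧ not (a ==ᶠ v)

    count-remove : ∀ S v → S v ≡ true → count S ≡ suc (count (S -ᵛ v))
    count-remove S v Sv = begin
      count S                                 ≡⟨ sum-cong-≗ split ⟩
      sum (λ a → [ (S -ᵛ v) a ] + [ a ==ᶠ v ]) ≡⟨ ∑-distrib-+ (λ a → [ (S -ᵛ v) a ]) (λ a → [ a ==ᶠ v ]) ⟩
      count (S -ᵛ v) + count (_==ᶠ v)          ≡⟨ cong (count (S -ᵛ v) +_) (count-==ᶠ v) ⟩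
      count (S -ᵛ v) + 1                      ≡⟨ +-comm (count (S -ᵛ v)) 1 ⟩
      suc (count (S -ᵛ v))                    ∎
      where
      open ≡-Reasoning
      split : ∀ a → [ S a ] ≡ [ (S -ᵛ v) a ] + [ a ==ᶠ v ]
      split a with a Fin.≟ v
      ... | yes refl rewrite Sv = refl
      ... | no _ rewrite ∧-identityʳ (S a) = sym (+-identityʳ _)

    arcsIn-remove : ∀ S v → S v ≡ true → arcsIn S ≤ arcsIn (S -ᵛ v) + (degIn S v + degIn S v)
    arcsIn-remove S v Sv = begin
      arcsIn S
        ≤⟨ sum-mono-≤ (λ a → sum-mono-≤ (split a)) ⟩
      sum (λ a → sum (λ b → [ (S -ᵛ v) a ∧ (S -ᵛ v) b ∧ G a b ] + (from-v a b + into-v a b)))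
        ≡⟨ sum-cong-≗ (λ a → ∑-distrib-+ (λ b → [ (S -ᵛ v) a ∧ (S -ᵛ v) b ∧ G a b ]) (λ b → from-v a b + into-v a b)) ⟩
      sum (λ a → sum (λ b → [ (S -ᵛ v) a ∧ (S -ᵛ v) b ∧ G a b ]) + sum (λ b → from-v a b + into-v a b))
        ≡⟨ ∑-distrib-+ (λ a → sum (λ b → [ (S -ᵛ v) a ∧ (S -ᵛ v) b ∧ G a b ])) (λ a → sum (λ b → from-v a b + into-v a b)) ⟩
      arcsIn (S -ᵛ v) + sum (λ a → sum (λ b → from-v a b + into-v a b))
        ≡⟨ cong (arcsIn (S -ᵛ v) +_) (trans (sum-cong-≗ (λ a → ∑-distrib-+ (from-v a) (into-v a)))
                                            (∑-distrib-+ (λ a → sum (from-v a)) (λ a → sum (into-v a)))) ⟩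
      arcsIn (S -ᵛ v) + (sum (λ a → sum (from-v a)) + sum (λ a → sum (into-v a)))
        ≡⟨ cong₂ (λ x y → arcsIn (S -ᵛ v) + (x + y)) arcs-from-v arcs-into-v ⟩
      arcsIn (S -ᵛ v) + (degIn S v + degIn S v) ∎
      where
      open ≤-Reasoning
      from-v into-v : Fin n → Fin n → ℕ
      from-v a b = [ a ==ᶠ v ] * [ S b ∧ G v b ]
      into-v a b = [ b ==ᶠ v ] * [ S a ∧ G a v ]
      split : ∀ a b → [ S a ∧ S b ∧ G a b ] ≤ [ (S -ᵛ v) a ∧ (S -ᵛ v) b ∧ G a b ] + (from-v a b + into-v a b)
      split a b with a Fin.≟ v
      ... | yes refl rewrite Sv = ≤-trans (≤-reflexive (sym (+-identityʳ _))) (m≤m+n _ _)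
      ... | no _ with b Fin.≟ v
      ...   | yes refl rewrite Sv | ∧-zeroʳ (S a ∧ true) = ≤-reflexive (sym (+-identityʳ _))
      ...   | no _ rewrite ∧-identityʳ (S a) | ∧-identityʳ (S b) = m≤m+n _ _
      arcs-from-v : sum (λ a → sum (from-v a)) ≡ degIn S v
      arcs-from-v = trans (sum-cong-≗ (λ a → sym (*-distribˡ-sum [ a ==ᶠ v ] (λ b → [ S b ∧ G v b ]))))
                          (sum-δ v (λ _ → degIn S v))
      arcs-into-v : sum (λ a → sum (into-v a)) ≡ degIn S v
      arcs-into-v = sum-cong-≗ (λ a → trans (sum-δ v (λ _ → [ S a ∧ G a v ])) (cong (λ t → [ S a ∧ t ]) (sym-G a v)))

    arcsIn≤2*count : ∀ S → arcsIn S ≤ count S + count S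
    arcsIn≤2*count S = go (count S) S refl
      where
      go : ∀ k S → count S ≡ k → arcsIn S ≤ k + k
      go zero S |S|≡0 = ≤-reflexive (sum-zero λ a → sum-zero λ b →
        cong (λ t → [ t ∧ S b ∧ G a b ]) (count≡0⇒∉ S |S|≡0 a))
      go (suc k) S |S|≡1+k with any (λ v → S v ∧ (degIn S v <ᵇ 2)) (allFin n) in e
      ... | true = let v , leaf = any-elim (λ v → S v ∧ (degIn S v <ᵇ 2)) e
                       Sv = ∧-elimˡ leaf
                       deg≤1 = ≤-pred (<ᵇ⇒< (degIn S v) 2 (Equivalence.from T-≡ (∧-elimʳ {S v} leaf))) in begin
        arcsIn S                                    ≤⟨ arcsIn-remove S v Sv ⟩
        arcsIn (S -ᵛ v) + (degIn S v + degIn S v)   ≤⟨ +-mono-≤ (go k (S -ᵛ v) (suc-injective (trans (sym (count-remove S v Sv)) |S|≡1+k)))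
                                                                (+-mono-≤ deg≤1 deg≤1) ⟩
        k + k + 2                                   ≡⟨ trans (+-comm (k + k) 2) (cong suc (sym (+-suc k k))) ⟩
        suc k + suc k                               ∎
        where open ≤-Reasoning
      ... | false = ⊥-elim (minDegree≥2⇒empty S deg≥2 (proj₁ nonempty) (proj₂ nonempty))
        where
        nonempty : ∃ λ v → S v ≡ true
        nonempty = count>0⇒∈ S (subst (1 ≤_) (sym |S|≡1+k) (s≤s z≤n))
        deg≥2 : ∀ v → S v ≡ true → 2 ≤ degIn S v
        deg≥2 v Sv = ≮⇒≥ λ deg<2 → true≢false (any-intro (λ v → S v ∧ (degIn S v <ᵇ 2)) v
                       (∧-intro Sv (Equivalence.to T-≡ (<⇒<ᵇ deg<2)))) e

  least : (ℕ → Bool) → ℕ → ℕ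
  least f zero = 0
  least f (suc m) = if f 0 then 0 else suc (least (f ∘ suc) m)

  least-satisfies : ∀ f m j → f j ≡ true → j ≤ m → f (least f m) ≡ true × least f m ≤ j
  least-satisfies f zero zero fj z≤n = fj , z≤n
  least-satisfies f (suc m) j fj j≤m with f 0 in f0
  ... | true = f0 , z≤n
  least-satisfies f (suc m) zero fj j≤m | false = ⊥-elim (true≢false fj f0)
  least-satisfies f (suc m) (suc j) fj (s≤s j≤m) | false =
    let fl , l≤j = least-satisfies (f ∘ suc) m j fj j≤m in fl , s≤s l≤j

  least≤ : ∀ f m → least f m ≤ m
  least≤ f zero = z≤n
  least≤ f (suc m) with f 0
  ... | true = z≤n
  ... | false = s≤s (least≤ (f ∘ suc) m)

  <least-fails : ∀ f m k → k < least f m → f k ≡ false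
  <least-fails f (suc m) k k<l with f 0 in f0
  <least-fails f (suc m) zero (s≤s _) | false = f0
  <least-fails f (suc m) (suc k) (s≤s k<l) | false = <least-fails (f ∘ suc) m k k<l

  minimal-index : ∀ {n} (p : Fin n → Bool) v → p v ≡ true → ∃ λ m → p m ≡ true × (∀ w → p w ≡ true → toℕ m ≤ toℕ w)
  minimal-index {n} p v pv = go (suc (toℕ v)) v pv ≤-refl
    where
    smaller : Fin n → Fin n → Bool
    smaller v w = p w ∧ w <ᶠ v
    go : ∀ fuel v → p v ≡ true → toℕ v < fuel → ∃ λ m → p m ≡ true × (∀ w → p w ≡ true → toℕ m ≤ toℕ w)
    go (suc fuel) v pv (s≤s v<fuel) with any (smaller v) (allFin n) in e
    ... | true = let w , pw∧w<v = any-elim (smaller v) e in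
      go fuel w (∧-elimˡ pw∧w<v) (≤-trans (<ᶠ⇒< (∧-elimʳ {p w} pw∧w<v)) v<fuel)
    ... | false = v , pv , λ w pw → ≮⇒≥ λ w<v →
      true≢false (any-intro (smaller v) w (∧-intro pw (<⇒<ᶠ w<v))) e

  []≤[∧]+ : ∀ b c {x} → (b ≡ true → c ≡ false → 1 ≤ x) → [ b ] ≤ [ b ∧ c ] + x
  []≤[∧]+ false c _ = z≤n
  []≤[∧]+ true true _ = s≤s z≤n
  []≤[∧]+ true false 1≤x = 1≤x refl refl

  module RemovedEdges {n} (isHigh isLarge : ℕ → Bool) (G : Adj n) (forest : IsForest G) where
    open Construction isHigh isLarge G

    sym-G : Symmetric G
    sym-G = proj₁ forest

    irr-G : Irreflexive G
    irr-G = proj₁ (proj₂ forest)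

    open Reachability isHigh isLarge G sym-G
    open Forest G sym-G irr-G (proj₂ (proj₂ forest))

    isRoot : Fin n → Bool
    isRoot r = low r ∧ not (any (λ w → sameComp r w ∧ w <ᶠ r) (allFin n))

    root-minimal : ∀ r w → isRoot r ≡ true → sameComp r w ≡ true → toℕ r ≤ toℕ w
    root-minimal r w root c = ≮⇒≥ λ w<r → true≢false
      (any-intro (λ w → sameComp r w ∧ w <ᶠ r) w (∧-intro c (<⇒<ᶠ w<r))) (not≡true⇒≡false (∧-elimʳ {low r} root))

    root-exists : ∀ v → low v ≡ true → ∃ λ r → isRoot r ≡ true × sameComp r v ≡ true
    root-exists v lv with minimal-index (sameComp v) v (sameComp-refl v lv)
    ... | r , v~r , r-min = r , ∧-intro (sameComp⇒lowʳ v r v~r) (≡false⇒not≡true no-smaller) , sameComp-sym v r v~r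
      where
      no-smaller : any (λ w → sameComp r w ∧ w <ᶠ r) (allFin n) ≡ false
      no-smaller = any-false _ λ w → ≢true⇒≡false λ r~w∧w<r →
        <⇒≱ (<ᶠ⇒< (∧-elimʳ {sameComp r w} r~w∧w<r)) (r-min w (sameComp-trans v r w v~r (∧-elimˡ r~w∧w<r)))

    root-unique : ∀ r r' v → isRoot r ≡ true → isRoot r' ≡ true → sameComp r v ≡ true → sameComp r' v ≡ true → r ≡ r'
    root-unique r r' v root root' c c' = toℕ-injective (≤-antisym
      (root-minimal r r' root (sameComp-trans r v r' c (sameComp-sym r' v c')))
      (root-minimal r' r root' (sameComp-trans r' v r c' (sameComp-sym r v c))))

    count-roots-reaching≤1 : ∀ (q : Fin n → Bool) v → (∀ r → q r ≡ true → isRoot r ≡ true) →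
      count (λ r → q r ∧ sameComp r v) ≤ 1
    count-roots-reaching≤1 q v q⇒root = count-≤1 _ λ r r' qr qr' →
      root-unique r r' v (q⇒root r (∧-elimˡ qr)) (q⇒root r' (∧-elimˡ qr')) (∧-elimʳ {q r} qr) (∧-elimʳ {q r'} qr')

    detached : Fin n → Bool
    detached v = low v ∧ not (keepLH v)

    reachedFromRoot : Fin n → ℕ → Bool
    reachedFromRoot v k = any (λ r → isRoot r ∧ reach k r v) (allFin n)

    depth : Fin n → ℕ
    depth v = least (reachedFromRoot v) n

    depth≤ : ∀ v k r → isRoot r ≡ true → reach k r v ≡ true → k ≤ n → depth v ≤ k
    depth≤ v k r root r↝v k≤n =
      proj₂ (least-satisfies (reachedFromRoot v) n k (any-intro (λ r → isRoot r ∧ reach k r v) r (∧-intro root r↝v)) k≤n)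

    reached-at-depth : ∀ v → low v ≡ true → reachedFromRoot v (depth v) ≡ true
    reached-at-depth v lv = let r , root , r~v = root-exists v lv in
      proj₁ (least-satisfies (reachedFromRoot v) n n (any-intro (λ r → isRoot r ∧ reach n r v) r (∧-intro root r~v)) ≤-refl)

    depth≡0⇒root : ∀ v → low v ≡ true → depth v ≡ 0 → isRoot v ≡ true
    depth≡0⇒root v lv d≡0 =
      let r , root∧r↝v = any-elim (λ r → isRoot r ∧ reach 0 r v) (subst (λ d → reachedFromRoot v d ≡ true) d≡0 (reached-at-depth v lv))
      in subst (λ x → isRoot x ≡ true) (==ᶠ⇒≡ (∧-elimʳ {low r} (∧-elimʳ {isRoot r} root∧r↝v))) (∧-elimˡ root∧r↝v)

    depth≡suc⇒predecessor : ∀ v k → low v ≡ true → depth v ≡ suc k →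
      ∃ λ w → sameComp w v ≡ true × G w v ≡ true × depth w ≤ k
    depth≡suc⇒predecessor v k lv d≡1+k
      with any-elim (λ r → isRoot r ∧ reach (suc k) r v) (subst (λ d → reachedFromRoot v d ≡ true) d≡1+k (reached-at-depth v lv))
    ... | r , root∧r↝v with ∨-elim {reach k r v} (∧-elimʳ {isRoot r} root∧r↝v)
    ...   | inj₁ r↝ₖv = ⊥-elim (true≢false
              (any-intro (λ r → isRoot r ∧ reach k r v) r (∧-intro (∧-elimˡ root∧r↝v) r↝ₖv))
              (<least-fails (reachedFromRoot v) n k (subst (k <_) (sym d≡1+k) ≤-refl)))
    ...   | inj₂ last-step =
      let w , r↝w , w-v = reach-last-step k r v last-step
          k≤n = ≤-trans (n≤1+n k) (subst (_≤ n) d≡1+k (least≤ (reachedFromRoot v) n))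
      in w , sameComp-trans w r v (sameComp-sym r w (reach⇒sameComp k r w r↝w))
                                  (reach⇒sameComp (suc k) r v (∧-elimʳ {isRoot r} root∧r↝v))
           , w-v , depth≤ w k r (∧-elimˡ root∧r↝v) r↝w k≤n

    parent : ∀ v → detached v ≡ true → isRoot v ≡ false →
      ∃ λ w → detached w ≡ true × G w v ≡ true × depth w < depth v
    parent v det non-root with depth v in d≡
    ... | zero = ⊥-elim (true≢false (depth≡0⇒root v (∧-elimˡ det) d≡) non-root)
    ... | suc k = let w , w~v , w-v , dw≤k = depth≡suc⇒predecessor v k (∧-elimˡ det) d≡ in
      w , ∧-intro (sameComp⇒lowʳ v w (sameComp-sym w v w~v)) (trans (cong not (keepLH-congˡ w v w~v)) (∧-elimʳ {low v} det))
        , w-v , s≤s dw≤k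

    treeArc : Adj n
    treeArc a v = edgeIn detached a v ∧ (depth a <ᵇ depth v)

    -- Every detached vertex other than a root has a parent, one level closer to the root.
    detached≤roots+treeArcs : count detached ≤ count (λ v → detached v ∧ isRoot v) + countArcs treeArc
    detached≤roots+treeArcs = begin
      count detached
        ≤⟨ sum-mono-≤ root-or-child ⟩
      sum (λ v → [ detached v ∧ isRoot v ] + sum (λ a → [ treeArc a v ]))
        ≡⟨ ∑-distrib-+ (λ v → [ detached v ∧ isRoot v ]) (λ v → sum (λ a → [ treeArc a v ])) ⟩
      count (λ v → detached v ∧ isRoot v) + sum (λ v → sum (λ a → [ treeArc a v ]))
        ≡⟨ cong (count (λ v → detached v ∧ isRoot v) +_) (∑-comm (λ a v → [ treeArc a v ])) ⟨
      count (λ v → detached v ∧ isRoot v) + countArcs treeArc ∎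
      where
      open ≤-Reasoning
      root-or-child : ∀ v → [ detached v ] ≤ [ detached v ∧ isRoot v ] + sum (λ a → [ treeArc a v ])
      root-or-child v = []≤[∧]+ (detached v) (isRoot v) λ det non-root →
        let w , det-w , w-v , dw<dv = parent v det non-root in begin
          1                               ≡⟨ cong [_] (∧-intro (∧-intro det-w (∧-intro det w-v)) (Equivalence.to T-≡ (<⇒<ᵇ dw<dv))) ⟨
          [ treeArc w v ]                 ≤⟨ ≤-sum (λ a → [ treeArc a v ]) w ⟩
          sum (λ a → [ treeArc a v ])     ∎

    treeArcs+treeArcs≤arcsIn : countArcs treeArc + countArcs treeArc ≤ arcsIn detached
    treeArcs+treeArcs≤arcsIn = begin
      countArcs treeArc + countArcs treeArc
        ≡⟨ cong (countArcs treeArc +_) (∑-comm (λ v a → [ treeArc v a ])) ⟩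
      countArcs treeArc + sum (λ a → sum (λ v → [ treeArc v a ]))
        ≡⟨ ∑-distrib-+ (λ a → sum (λ v → [ treeArc a v ])) (λ a → sum (λ v → [ treeArc v a ])) ⟨
      sum (λ a → sum (λ v → [ treeArc a v ]) + sum (λ v → [ treeArc v a ]))
        ≡⟨ sum-cong-≗ (λ a → ∑-distrib-+ (λ v → [ treeArc a v ]) (λ v → [ treeArc v a ])) ⟨
      sum (λ a → sum (λ v → [ treeArc a v ] + [ treeArc v a ]))
        ≤⟨ sum-mono-≤ (λ a → sum-mono-≤ (λ v → one-direction a v)) ⟩
      arcsIn detached ∎
      where
      open ≤-Reasoning
      one-direction : ∀ a v → [ treeArc a v ] + [ treeArc v a ] ≤ [ edgeIn detached a v ]
      one-direction a v = []+[]≤[] (∧-elimˡ {edgeIn detached a v}) (λ e → trans (edgeIn-sym detached a v) (∧-elimˡ e))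
        λ a<v v<a → <-asym (<ᵇ⇒< (depth a) (depth v) (Equivalence.from T-≡ (∧-elimʳ {edgeIn detached a v} a<v)))
                           (<ᵇ⇒< (depth v) (depth a) (Equivalence.from T-≡ (∧-elimʳ {edgeIn detached v a} v<a)))

    removed : Adj n
    removed a b = G a b ∧ not (keep a b)

    touched : Fin n → Bool
    touched v = high v ∨ detached v

    count-touched : count touched ≡ count high + count detached
    count-touched = trans (sum-cong-≗ (λ v → split (high v) (not (keepLH v)))) (∑-distrib-+ (λ v → [ high v ]) (λ v → [ detached v ]))
      where
      split : ∀ h x → [ h ∨ (not h ∧ x) ] ≡ [ h ] + [ not h ∧ x ]
      split true _ = refl
      split false _ = refl

    arcsIn-touched : arcsIn touched ≡ countArcs removed + arcsIn detached
    arcsIn-touched = trans (sum-cong-≗ λ a → trans (sum-cong-≗ λ b → split (high a) (high b) (keepLH a) (keepLH b) (G a b))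
                                                   (∑-distrib-+ (λ b → [ removed a b ]) (λ b → [ edgeIn detached a b ])))
                           (∑-distrib-+ (λ a → sum (λ b → [ removed a b ])) (λ a → sum (λ b → [ edgeIn detached a b ])))
      where
      split : ∀ ha hb ka kb g → [ (ha ∨ (not ha ∧ not ka)) ∧ (hb ∨ (not hb ∧ not kb)) ∧ g ]
                                ≡ [ g ∧ not (keepᵇ ha hb ka kb) ] + [ (not ha ∧ not ka) ∧ (not hb ∧ not kb) ∧ g ]
      split true true _ _ true = refl
      split true true _ _ false = refl
      split true false _ true true = refl
      split true false _ true false = refl
      split true false _ false true = refl
      split true false _ false false = refl
      split false true true _ true = refl
      split false true true _ false = refl
      split false true false _ true = refl
      split false true false _ false = refl
      split false false _ _ true = refl
      split false false _ _ false = refl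

    detachedRoots : ℕ
    detachedRoots = count (λ v → detached v ∧ isRoot v)

    removed≤high+detachedRoots : countArcs removed ≤ (count high + detachedRoots) + (count high + detachedRoots)
    removed≤high+detachedRoots = +-cancelʳ-≤ (t + t) (countArcs removed) _ (begin
      countArcs removed + (t + t)             ≤⟨ +-monoʳ-≤ (countArcs removed) treeArcs+treeArcs≤arcsIn ⟩
      countArcs removed + arcsIn detached     ≡⟨ arcsIn-touched ⟨
      arcsIn touched                          ≤⟨ arcsIn≤2*count touched ⟩
      count touched + count touched           ≡⟨ cong (λ t → t + t) count-touched ⟩
      (h + d) + (h + d)                       ≤⟨ +-mono-≤ (+-monoʳ-≤ h detached≤roots+treeArcs) (+-monoʳ-≤ h detached≤roots+treeArcs) ⟩
      (h + (r + t)) + (h + (r + t))           ≡⟨ regroup h r t ⟩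
      ((h + r) + (h + r)) + (t + t)           ∎)
      where
      open ≤-Reasoning
      h d r t : ℕ
      h = count high
      d = count detached
      r = detachedRoots
      t = countArcs treeArc
      regroup : ∀ h r t → (h + (r + t)) + (h + (r + t)) ≡ ((h + r) + (h + r)) + (t + t)
      regroup = solve-∀

    largeRoot multiRoot : Fin n → Bool
    largeRoot r = isRoot r ∧ large r
    multiRoot r = isRoot r ∧ not (highNbrs r <ᵇ 2)

    detachedRoots≤large+multi : detachedRoots ≤ count largeRoot + count multiRoot
    detachedRoots≤large+multi = count-subadditive λ r det∧root →
      let root = ∧-elimʳ {detached r} det∧root in
      case-large (large r) (highNbrs r <ᵇ 2) (∧-elimʳ {low r} (∧-elimˡ det∧root)) root
      where
      case-large : ∀ l k {ρ} → not (not l ∧ k) ≡ true → ρ ≡ true → ρ ∧ l ≡ true ⊎ ρ ∧ not k ≡ true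
      case-large true _ refl refl = inj₁ refl
      case-large false false _ refl = inj₂ refl

    detachedHigh : Adj n
    detachedHigh v h = detached v ∧ high h ∧ G v h

    detachedHigh⇒removed : ∀ v h → detachedHigh v h ≡ true → removed v h ≡ true
    detachedHigh⇒removed v h e = cut {G v h} {high v} {high h} {keepLH v} {keepLH h}
      (∧-elimʳ {high h} (∧-elimʳ {detached v} e)) (not≡true⇒≡false (∧-elimˡ {low v} (∧-elimˡ {detached v} e)))
      (∧-elimˡ {high h} (∧-elimʳ {detached v} e)) (not≡true⇒≡false (∧-elimʳ {low v} (∧-elimˡ {detached v} e)))
      where
      cut : ∀ {g hv hh kv kh} → g ≡ true → hv ≡ false → hh ≡ true → kv ≡ false → g ∧ not (keepᵇ hv hh kv kh) ≡ true
      cut refl refl refl refl = refl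

    highDetached⇒removed : ∀ h v → detachedHigh v h ≡ true → removed h v ≡ true
    highDetached⇒removed h v e =
      trans (cong₂ (λ g k → g ∧ not k) (sym-G h v) (keepᵇ-sym (high h) (high v) (keepLH h) (keepLH v))) (detachedHigh⇒removed v h e)

    detachedHigh+detachedHigh≤removed : countArcs detachedHigh + countArcs detachedHigh ≤ countArcs removed
    detachedHigh+detachedHigh≤removed = begin
      countArcs detachedHigh + countArcs detachedHigh
        ≡⟨ cong (countArcs detachedHigh +_) (∑-comm (λ a b → [ detachedHigh a b ])) ⟩
      countArcs detachedHigh + sum (λ b → sum (λ a → [ detachedHigh a b ]))
        ≡⟨ ∑-distrib-+ (λ a → sum (λ b → [ detachedHigh a b ])) (λ a → sum (λ b → [ detachedHigh b a ])) ⟨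
      sum (λ a → sum (λ b → [ detachedHigh a b ]) + sum (λ b → [ detachedHigh b a ]))
        ≡⟨ sum-cong-≗ (λ a → ∑-distrib-+ (λ b → [ detachedHigh a b ]) (λ b → [ detachedHigh b a ])) ⟨
      sum (λ a → sum (λ b → [ detachedHigh a b ] + [ detachedHigh b a ]))
        ≤⟨ sum-mono-≤ (λ a → sum-mono-≤ (λ b → []+[]≤[] (detachedHigh⇒removed a b) (highDetached⇒removed a b) (exclusive a b))) ⟩
      countArcs removed ∎
      where
      open ≤-Reasoning
      exclusive : ∀ a b → detachedHigh a b ≡ true → detachedHigh b a ≡ true → ⊥
      exclusive a b ab ba = true≢false (∧-elimˡ {high b} (∧-elimʳ {detached a} ab))
        (not≡true⇒≡false (∧-elimˡ {low b} (∧-elimˡ {detached b} ba)))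

    multiRoot-component-detached : ∀ r v → multiRoot r ≡ true → sameComp r v ≡ true → detached v ≡ true
    multiRoot-component-detached r v multi r~v = ∧-intro (sameComp⇒lowʳ r v r~v)
      (trans (cong not (trans (keepLH-congˡ v r (sameComp-sym r v r~v))
                              (cong (not (large r) ∧_) (not≡true⇒≡false (∧-elimʳ {isRoot r} multi)))))
             (cong not (∧-zeroʳ (not (large r)))))

    multi+multi≤detachedHigh : count multiRoot + count multiRoot ≤ countArcs detachedHigh
    multi+multi≤detachedHigh = begin
      count multiRoot + count multiRoot
        ≡⟨ ∑-distrib-+ (λ r → [ multiRoot r ]) (λ r → [ multiRoot r ]) ⟨
      sum (λ r → [ multiRoot r ] + [ multiRoot r ])
        ≤⟨ sum-mono-≤ two-high-neighbours ⟩
      sum (λ r → [ multiRoot r ] * count (adjacentHigh r))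
        ≡⟨ sum-cong-≗ (λ r → *-distribˡ-sum [ multiRoot r ] (λ h → [ adjacentHigh r h ])) ⟩
      sum (λ r → sum (λ h → [ multiRoot r ] * [ adjacentHigh r h ]))
        ≤⟨ sum-mono-≤ (λ r → sum-mono-≤ (λ h → witness r h)) ⟩
      sum (λ r → sum (λ h → sum (W r h)))
        ≡⟨ trans (∑-comm (λ r h → sum (W r h))) (sum-cong-≗ λ h → ∑-comm (λ r v → W r h v)) ⟩
      sum (λ h → sum (λ v → sum (λ r → W r h v)))
        ≤⟨ sum-mono-≤ (λ h → sum-mono-≤ (λ v → one-root h v)) ⟩
      sum (λ h → sum (λ v → [ detachedHigh v h ]))
        ≡⟨ ∑-comm (λ v h → [ detachedHigh v h ]) ⟨
      countArcs detachedHigh ∎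
      where
      open ≤-Reasoning
      adjacentHigh : Fin n → Fin n → Bool
      adjacentHigh r h = high h ∧ any (λ v → sameComp r v ∧ G v h) (allFin n)
      W : Fin n → Fin n → Fin n → ℕ
      W r h v = [ multiRoot r ∧ sameComp r v ] * [ high h ∧ G v h ]
      two-high-neighbours : ∀ r → [ multiRoot r ] + [ multiRoot r ] ≤ [ multiRoot r ] * count (adjacentHigh r)
      two-high-neighbours r with multiRoot r in multi
      ... | false = z≤n
      ... | true = ≤-trans (≮⇒≥ λ lt → true≢false (Equivalence.to T-≡ (<⇒<ᵇ (subst (_< 2) (sym (countᵇ-allFin (adjacentHigh r))) lt)))
                                                    (not≡true⇒≡false (∧-elimʳ {isRoot r} multi)))
                           (≤-reflexive (sym (+-identityʳ _)))
      witness : ∀ r h → [ multiRoot r ] * [ adjacentHigh r h ] ≤ sum (W r h)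
      witness r h = []*[]≤ (multiRoot r) (adjacentHigh r h) λ multi adj →
        let v , r~v∧v-h = any-elim (λ v → sameComp r v ∧ G v h) (∧-elimʳ {high h} adj) in begin
        1         ≡⟨ cong₂ _*_ (cong [_] (∧-intro multi (∧-elimˡ r~v∧v-h)))
                               (cong [_] (∧-intro (∧-elimˡ adj) (∧-elimʳ {sameComp r v} r~v∧v-h))) ⟨
        W r h v   ≤⟨ ≤-sum (W r h) v ⟩
        sum (W r h) ∎
      one-root : ∀ h v → sum (λ r → W r h v) ≤ [ detachedHigh v h ]
      one-root h v = begin
        sum (λ r → [ multiRoot r ∧ sameComp r v ] * [ high h ∧ G v h ])
          ≡⟨ *-distribʳ-sum [ high h ∧ G v h ] (λ r → [ multiRoot r ∧ sameComp r v ]) ⟨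
        count (λ r → multiRoot r ∧ sameComp r v) * [ high h ∧ G v h ]
          ≤⟨ *-monoˡ-≤ [ high h ∧ G v h ] (count≤[] (count-roots-reaching≤1 multiRoot v (λ r → ∧-elimˡ))
                                                     (λ r m∧r~v → multiRoot-component-detached r v (∧-elimˡ m∧r~v) (∧-elimʳ {multiRoot r} m∧r~v))) ⟩
        [ detached v ] * [ high h ∧ G v h ]
          ≡⟨ [∧]≡[]*[] (detached v) (high h ∧ G v h) ⟨
        [ detachedHigh v h ] ∎

    removed≤4*high+4*largeRoots : countArcs removed ≤ 4 * count high + 4 * count largeRoot
    removed≤4*high+4*largeRoots = +-cancelʳ-≤ R R (4 * h + 4 * L) (begin
      R + R                                       ≤⟨ +-mono-≤ R≤ R≤ ⟩
      (h + (L + M)) + (h + (L + M)) + ((h + (L + M)) + (h + (L + M)))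
                                                  ≡⟨ regroup h L M ⟩
      (4 * h + 4 * L) + ((M + M) + (M + M))       ≤⟨ +-monoʳ-≤ (4 * h + 4 * L) 4M≤R ⟩
      (4 * h + 4 * L) + R                         ∎)
      where
      open ≤-Reasoning
      R h L M : ℕ
      R = countArcs removed
      h = count high
      L = count largeRoot
      M = count multiRoot
      h+r≤h+L+M : h + detachedRoots ≤ h + (L + M)
      h+r≤h+L+M = +-monoʳ-≤ h detachedRoots≤large+multi
      R≤ : R ≤ (h + (L + M)) + (h + (L + M))
      R≤ = ≤-trans removed≤high+detachedRoots (+-mono-≤ h+r≤h+L+M h+r≤h+L+M)
      4M≤R : (M + M) + (M + M) ≤ R
      4M≤R = ≤-trans (+-mono-≤ multi+multi≤detachedHigh multi+multi≤detachedHigh) detachedHigh+detachedHigh≤removed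
      regroup : ∀ h L M → (h + (L + M)) + (h + (L + M)) + ((h + (L + M)) + (h + (L + M)))
                          ≡ (4 * h + 4 * L) + ((M + M) + (M + M))
      regroup = solve-∀

    G'-sym : Symmetric G'
    G'-sym a b = cong₂ _∧_ (sym-G a b) (keepᵇ-sym (high a) (high b) (keepLH a) (keepLH b))

    G'-irr : Irreflexive G'
    G'-irr a = cong (_∧ keep a a) (irr-G a)

    removed≡2*diffPairs : countArcs removed ≡ diffPairs G G' + diffPairs G G'
    removed≡2*diffPairs = trans (sum-cong-≗ λ a → sum-cong-≗ λ b → cong [_] (sym (xor-∧ (G a b) (keep a b))))
      (countArcs≡countPairs+countPairs (λ a b → cong₂ xor (sym-G a b) (G'-sym a b)) (λ a → cong₂ xor (irr-G a) (G'-irr a)))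
      where
      xor-∧ : ∀ g k → xor g (g ∧ k) ≡ g ∧ not k
      xor-∧ false _ = refl
      xor-∧ true false = refl
      xor-∧ true true = refl

    module _ (Th : ℕ) (high⇒Th≤ : ∀ d → isHigh d ≡ true → Th ≤ d) (large⇒Th≤ : ∀ d → isLarge d ≡ true → Th ≤ d) where

      Th*high≤2n : Th * count high ≤ n + n
      Th*high≤2n = begin
        Th * count high                  ≡⟨ *-distribˡ-sum Th (λ v → [ high v ]) ⟩
        sum (λ v → Th * [ high v ])      ≤⟨ sum-mono-≤ Th≤deg ⟩
        sum (λ v → count (G v))          ≤⟨ arcsIn≤2*count (λ _ → true) ⟩
        count {n} (λ _ → true) + count {n} (λ _ → true) ≤⟨ +-mono-≤ (count≤n {n} (λ _ → true)) (count≤n {n} (λ _ → true)) ⟩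
        n + n ∎
        where
        open ≤-Reasoning
        Th≤deg : ∀ v → Th * [ high v ] ≤ count (G v)
        Th≤deg v with high v in hv
        ... | false = ≤-trans (≤-reflexive (*-zeroʳ Th)) z≤n
        ... | true = ≤-trans (≤-reflexive (*-identityʳ Th)) (≤-trans (high⇒Th≤ (deg v) hv) (≤-reflexive (countᵇ-allFin (G v))))

      Th*largeRoots≤n : Th * count largeRoot ≤ n
      Th*largeRoots≤n = begin
        Th * count largeRoot                                  ≡⟨ *-distribˡ-sum Th (λ r → [ largeRoot r ]) ⟩
        sum (λ r → Th * [ largeRoot r ])                      ≤⟨ sum-mono-≤ Th≤size ⟩
        sum (λ r → [ largeRoot r ] * count (sameComp r))      ≡⟨ sum-cong-≗ (λ r → *-distribˡ-sum [ largeRoot r ] (λ v → [ sameComp r v ])) ⟩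
        sum (λ r → sum (λ v → [ largeRoot r ] * [ sameComp r v ])) ≡⟨ ∑-comm (λ r v → [ largeRoot r ] * [ sameComp r v ]) ⟩
        sum (λ v → sum (λ r → [ largeRoot r ] * [ sameComp r v ])) ≡⟨ sum-cong-≗ (λ v → sum-cong-≗ (λ r → sym ([∧]≡[]*[] (largeRoot r) (sameComp r v)))) ⟩
        sum (λ v → count (λ r → largeRoot r ∧ sameComp r v)) ≤⟨ sum-mono-≤ (λ v → count-roots-reaching≤1 largeRoot v (λ r → ∧-elimˡ)) ⟩
        count {n} (λ _ → true)                                ≤⟨ count≤n {n} (λ _ → true) ⟩
        n ∎
        where
        open ≤-Reasoning
        Th≤size : ∀ r → Th * [ largeRoot r ] ≤ [ largeRoot r ] * count (sameComp r)
        Th≤size r with largeRoot r in lr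
        ... | false = ≤-reflexive (*-zeroʳ Th)
        ... | true = begin
          Th * 1                  ≡⟨ *-identityʳ Th ⟩
          Th                      ≤⟨ large⇒Th≤ (compSize r) (∧-elimʳ {isRoot r} lr) ⟩
          compSize r              ≡⟨ countᵇ-allFin (sameComp r) ⟩
          count (sameComp r)      ≡⟨ +-identityʳ _ ⟨
          1 * count (sameComp r)  ∎

      Th*removed≤12n : Th * countArcs removed ≤ 12 * n
      Th*removed≤12n = begin
        Th * countArcs removed                    ≤⟨ *-monoʳ-≤ Th removed≤4*high+4*largeRoots ⟩
        Th * (4 * count high + 4 * count largeRoot) ≡⟨ distribute Th (count high) (count largeRoot) ⟩
        4 * (Th * count high) + 4 * (Th * count largeRoot) ≤⟨ +-mono-≤ (*-monoʳ-≤ 4 Th*high≤2n) (*-monoʳ-≤ 4 Th*largeRoots≤n) ⟩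
        4 * (n + n) + 4 * n                       ≡⟨ collect n ⟩
        12 * n ∎
        where
        open ≤-Reasoning
        distribute : ∀ t h l → t * (4 * h + 4 * l) ≡ 4 * (t * h) + 4 * (t * l)
        distribute = solve-∀
        collect : ∀ n → 4 * (n + n) + 4 * n ≡ 12 * n
        collect = solve-∀

      Th*diffPairs≤6n : Th * diffPairs G G' ≤ 6 * n
      Th*diffPairs≤6n = *-cancelˡ-≤ 2 (begin
        2 * (Th * diffPairs G G')                 ≡⟨ double Th (diffPairs G G') ⟩
        Th * (diffPairs G G' + diffPairs G G')    ≡⟨ cong (Th *_) removed≡2*diffPairs ⟨
        Th * countArcs removed                    ≤⟨ Th*removed≤12n ⟩
        12 * n                                    ≡⟨ *-assoc 2 6 n ⟩
        2 * (6 * n)                               ∎)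
        where
        open ≤-Reasoning
        double : ∀ t d → 2 * (t * d) ≡ t * (d + d)
        double = solve-∀

  module Relabelling {n} (isHigh isLarge : ℕ → Bool) {G H : Adj n} (σ : Permutation′ n)
                     (iso : ∀ i j → G i j ≡ H (σ ⟨$⟩ʳ i) (σ ⟨$⟩ʳ j)) where
    module g = Construction isHigh isLarge G
    module h = Construction isHigh isLarge H

    private
      ρ : Fin n → Fin n
      ρ i = σ ⟨$⟩ʳ i

      ==-ρ : ∀ u v → (u ==ᶠ v) ≡ (ρ u ==ᶠ ρ v)
      ==-ρ u v = true-ext (λ e → subst (λ x → (ρ u ==ᶠ ρ x) ≡ true) (==ᶠ⇒≡ {u = u} {v} e) (==ᶠ-refl (ρ u)))
                          (λ e → subst (λ x → (u ==ᶠ x) ≡ true) (ρ-injective (==ᶠ⇒≡ {u = ρ u} {ρ v} e)) (==ᶠ-refl u))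
        where
        ρ-injective : ∀ {u v} → ρ u ≡ ρ v → u ≡ v
        ρ-injective {u} {v} e = trans (sym (inverseˡ σ)) (trans (cong (σ ⟨$⟩ˡ_) e) (inverseˡ σ))

      countᵇ-ρ : ∀ p q → (∀ i → p i ≡ q (ρ i)) → countᵇ p (allFin n) ≡ countᵇ q (allFin n)
      countᵇ-ρ p q e = trans (countᵇ-allFin p) (trans (count-cong e) (trans (count-permute σ q) (sym (countᵇ-allFin q))))

      any-ρ : ∀ p q → (∀ i → p i ≡ q (ρ i)) → any p (allFin n) ≡ any q (allFin n)
      any-ρ p q e = trans (any-cong e) (any-permute σ q)

    high : ∀ v → g.high v ≡ h.high (ρ v)
    high v = cong isHigh (countᵇ-ρ (G v) (H (ρ v)) (iso v))

    reach : ∀ k u v → g.reach k u v ≡ h.reach k (ρ u) (ρ v)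
    reach zero u v = cong₂ _∧_ (cong not (high u)) (==-ρ u v)
    reach (suc k) u v = cong₂ _∨_ (reach k u v)
      (any-ρ (λ w → g.reach k u w ∧ G w v ∧ g.low v) (λ w → h.reach k (ρ u) w ∧ H w (ρ v) ∧ h.low (ρ v))
             (λ w → cong₂ _∧_ (reach k u w) (cong₂ _∧_ (iso w v) (cong not (high v)))))

    keepLH : ∀ u → g.keepLH u ≡ h.keepLH (ρ u)
    keepLH u = cong₂ (λ c m → not (isLarge c) ∧ (m <ᵇ 2))
      (countᵇ-ρ (g.sameComp u) (h.sameComp (ρ u)) (reach n u))
      (countᵇ-ρ (λ x → g.high x ∧ any (λ v → g.sameComp u v ∧ G v x) (allFin n))
                (λ x → h.high x ∧ any (λ v → h.sameComp (ρ u) v ∧ H v x) (allFin n))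
                (λ x → cong₂ _∧_ (high x) (any-ρ (λ v → g.sameComp u v ∧ G v x) (λ v → h.sameComp (ρ u) v ∧ H v (ρ x))
                                                  (λ v → cong₂ _∧_ (reach n u v) (iso v x)))))

    G' : ∀ u v → g.G' u v ≡ h.G' (ρ u) (ρ v)
    G' u v = cong₂ _∧_ (iso u v) (trans (cong₂ (λ hu hv → keepᵇ hu hv (g.keepLH u) (g.keepLH v)) (high u) (high v))
                                        (cong₂ (keepᵇ (h.high (ρ u)) (h.high (ρ v))) (keepLH u) (keepLH v)))

  exceeds : ℚ → ℕ → Bool
  exceeds s d = does (s ℚ.<? ℕtoℚ d)

  module _ {n} (s : ℚ) (G : Adj n) where
    private
      module p = Partition s G
      module c = Construction (exceeds s) (exceeds s) G

      reach : ∀ k u v → p.reach k u v ≡ c.reach k u v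
      reach zero u v = refl
      reach (suc k) u v = cong₂ _∨_ (reach k u v) (any-cong λ w → cong (_∧ (G w v ∧ c.low v)) (reach k u w))

      sameComp : ∀ u v → p.sameComp u v ≡ c.sameComp u v
      sameComp = reach n

      keepLH : ∀ u → p.keepLH u ≡ c.keepLH u
      keepLH u = cong₂ (λ size m → not (exceeds s size) ∧ (m <ᵇ 2))
        (trans (countᵇ-allFin (p.sameComp u)) (trans (count-cong (sameComp u)) (sym (countᵇ-allFin (c.sameComp u)))))
        (trans (countᵇ-allFin (λ h → p.high h ∧ any (λ v → p.sameComp u v ∧ G v h) (allFin n)))
        (trans (count-cong λ h → cong (c.high h ∧_) (any-cong λ v → cong (_∧ G v h) (sameComp u v)))
               (sym (countᵇ-allFin (λ h → c.high h ∧ any (λ v → c.sameComp u v ∧ G v h) (allFin n))))))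

    Partition-G'≡Construction-G' : ∀ u v → Partition.G' s G u v ≡ Construction.G' (exceeds s) (exceeds s) G u v
    Partition-G'≡Construction-G' u v = cong (G u v ∧_) (cong₂ (keepᵇ (c.high u) (c.high v)) (keepLH u) (keepLH v))

  editCount-cong : ∀ {n} {A A' B B' : Adj n} → (∀ i j → A i j ≡ A' i j) → (∀ i j → B i j ≡ B' i j) →
    ∀ σ → editCount A B σ ≡ editCount A' B' σ
  editCount-cong {A = A} {A'} {B} {B'} A≗A' B≗B' σ = trans (editCount≡countPairs A B σ) (trans
    (sum-cong-≗ λ i → sum-cong-≗ λ j → cong₂ (λ a b → [ i <ᶠ j ∧ xor a b ]) (A≗A' i j) (B≗B' (σ ⟨$⟩ʳ i) (σ ⟨$⟩ʳ j)))
    (sym (editCount≡countPairs A' B' σ)))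

  IsDist-cong : ∀ {n} {A A' B B' : Adj n} {k} → (∀ i j → A i j ≡ A' i j) → (∀ i j → B i j ≡ B' i j) →
    IsDist A B k → IsDist A' B' k
  IsDist-cong A≗A' B≗B' ((σ , e) , minimal) =
    (σ , trans (sym (editCount-cong A≗A' B≗B' σ)) e) , λ τ → ≤-trans (minimal τ) (≤-reflexive (editCount-cong A≗A' B≗B' τ))

  module _ {n} (isHigh isLarge : ℕ → Bool) {G H : Adj n} (forest-G : IsForest G) (forest-H : IsForest H) where
    private
      G' H' : Adj n
      G' = Construction.G' isHigh isLarge G
      H' = Construction.G' isHigh isLarge H

    construction-distance-zero : ∀ {d'} → IsDist G H 0 → IsDist G' H' d' → d' ≡ 0
    construction-distance-zero ((σ , e≡0) , _) (_ , minimal) = n≤0⇒n≡0 (≤-trans (minimal σ) (≤-reflexive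
      (isomorphism⇒editCount≡0 {G = G'} {H'} σ (Relabelling.G' isHigh isLarge {G} {H} σ
        (editCount≡0⇒isomorphism (proj₁ forest-G) (proj₁ (proj₂ forest-G)) (proj₁ forest-H) (proj₁ (proj₂ forest-H)) σ e≡0)))))

    construction-distance-bound : ∀ Th → (∀ d → isHigh d ≡ true → Th ≤ d) → (∀ d → isLarge d ≡ true → Th ≤ d) →
      ∀ {d d'} → IsDist G H d → IsDist G' H' d' → ∃ λ R → Th * R ≤ 12 * n × d ≤ R + d'
    construction-distance-bound Th high⇒ large⇒ {d} {d'} dist dist' = DG + DH , Th*R≤12n , d≤R+d'
      where
      DG DH : ℕ
      DG = diffPairs G G'
      DH = diffPairs H H'
      Th*R≤12n : Th * (DG + DH) ≤ 12 * n
      Th*R≤12n = begin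
        Th * (DG + DH)        ≡⟨ *-distribˡ-+ Th DG DH ⟩
        Th * DG + Th * DH     ≤⟨ +-mono-≤ (RemovedEdges.Th*diffPairs≤6n isHigh isLarge G forest-G Th high⇒ large⇒)
                                          (RemovedEdges.Th*diffPairs≤6n isHigh isLarge H forest-H Th high⇒ large⇒) ⟩
        6 * n + 6 * n         ≡⟨ *-distribʳ-+ n 6 6 ⟨
        12 * n                ∎
        where open ≤-Reasoning
      d≤R+d' : d ≤ (DG + DH) + d'
      d≤R+d' = ≤-trans (dist-triangle (proj₁ forest-H) (proj₁ (proj₂ forest-H))
                                      (RemovedEdges.G'-sym isHigh isLarge H forest-H) (RemovedEdges.G'-irr isHigh isLarge H forest-H) dist dist')
                       (≤-reflexive (regroup DG d' DH))
        where
        regroup : ∀ a b c → a + b + c ≡ (a + c) + b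
        regroup = solve-∀

module RationalBound where
  open import Data.Nat as ℕ using (ℕ; zero; suc; z≤n; s≤s)
  import Data.Nat.Properties as ℕ
  open import Data.Nat.Coprimality using (1-coprimeTo)
  import Data.Nat.Coprimality as Coprime
  open import Data.Integer as ℤ using (+_; -[1+_])
  import Data.Integer.Properties as ℤ
  open import Data.Rational
  open import Data.Rational.Properties
  open import Data.Rational.Solver using (module +-*-Solver)
  open +-*-Solver using (solve; _:=_; con; _:+_; _:*_; _:-_)
  open import Data.Product using (∃; _×_; _,_; proj₁; proj₂)
  open Combinatorics using (least; least-satisfies; exceeds)
  open import Data.Bool using (Bool; true)
  open import Relation.Nullary using (Dec; does; yes; no)
  open import Relation.Nullary.Decidable using (dec-true)
  open import Relation.Binary.PropositionalEquality

  ℕtoℚ≡mkℚ : ∀ m → ℕtoℚ m ≡ mkℚ (+ m) 0 (Coprime.sym (1-coprimeTo m))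
  ℕtoℚ≡mkℚ m = normalize-coprime (Coprime.sym (1-coprimeTo m))

  ℕtoℚ-mono-≤ : ∀ {a b} → a ℕ.≤ b → ℕtoℚ a ≤ ℕtoℚ b
  ℕtoℚ-mono-≤ {a} {b} a≤b rewrite ℕtoℚ≡mkℚ a | ℕtoℚ≡mkℚ b =
    *≤* (subst₂ ℤ._≤_ (sym (ℤ.*-identityʳ (+ a))) (sym (ℤ.*-identityʳ (+ b))) (ℤ.+≤+ a≤b))

  ℕtoℚ-+ : ∀ a b → ℕtoℚ (a ℕ.+ b) ≡ ℕtoℚ a + ℕtoℚ b
  ℕtoℚ-+ a b rewrite ℕtoℚ≡mkℚ a | ℕtoℚ≡mkℚ b =
    cong (_/ 1) (trans (ℤ.pos-+ a b) (sym (cong₂ ℤ._+_ (ℤ.*-identityʳ (+ a)) (ℤ.*-identityʳ (+ b)))))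

  ℕtoℚ-* : ∀ a b → ℕtoℚ (a ℕ.* b) ≡ ℕtoℚ a * ℕtoℚ b
  ℕtoℚ-* a b rewrite ℕtoℚ≡mkℚ a | ℕtoℚ≡mkℚ b = cong (_/ 1) (ℤ.pos-* a b)

  ℕtoℚ-nonNeg : ∀ m → 0ℚ ≤ ℕtoℚ m
  ℕtoℚ-nonNeg m = nonNegative⁻¹ (ℕtoℚ m) {{normalize-nonNeg m 1}}

  ℕ-above : ∀ s → ∃ λ m → s ≤ ℕtoℚ m
  ℕ-above (mkℚ (+ p) q c) = p , subst (mkℚ (+ p) q c ≤_) (sym (ℕtoℚ≡mkℚ p))
    (*≤* (subst₂ ℤ._≤_ (ℤ.pos-* p 1) (ℤ.pos-* p (suc q)) (ℤ.+≤+ (ℕ.*-monoʳ-≤ p (s≤s z≤n)))))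
  ℕ-above (mkℚ -[1+ p ] q c) = 0 , subst (mkℚ -[1+ p ] q c ≤_) (sym (ℕtoℚ≡mkℚ 0)) (*≤* ℤ.-≤+)


  does⇒ : ∀ {P : Set} (d : Dec P) → does d ≡ true → P
  does⇒ (yes p) _ = p

  threshold : ∀ s → ∃ λ Th → s ≤ ℕtoℚ Th × (∀ d → exceeds s d ≡ true → Th ℕ.≤ d)
  threshold s = Th , does⇒ (s ≤? ℕtoℚ Th) (proj₁ spec) , Th≤
    where
    P : ℕ
    P = proj₁ (ℕ-above s)
    above : ℕ → Bool
    above m = does (s ≤? ℕtoℚ m)
    Th : ℕ
    Th = least above P
    spec : above Th ≡ true × Th ℕ.≤ P
    spec = least-satisfies above P P (dec-true (s ≤? ℕtoℚ P) (proj₂ (ℕ-above s))) ℕ.≤-refl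
    Th≤ : ∀ d → exceeds s d ≡ true → Th ℕ.≤ d
    Th≤ d s<d with d ℕ.≤? P
    ... | yes d≤P = proj₂ (least-satisfies above P d (dec-true (s ≤? ℕtoℚ d) (<⇒≤ (does⇒ (s <? ℕtoℚ d) s<d))) d≤P)
    ... | no d≰P = ℕ.≤-trans (proj₂ spec) (ℕ.<⇒≤ (ℕ.≰⇒> d≰P))

  0≤-⇒≤ : ∀ {p q} → 0ℚ ≤ q - p → p ≤ q
  0≤-⇒≤ {p} {q} 0≤q-p = subst₂ _≤_ (+-identityˡ p) (q-p+p≡q p q) (+-monoˡ-≤ p 0≤q-p)
    where
    q-p+p≡q : ∀ p q → (q - p) + p ≡ q
    q-p+p≡q = solve 2 (λ p q → (q :- p) :+ p := q) refl

  ≤⇒0≤- : ∀ {p q} → p ≤ q → 0ℚ ≤ q - p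
  ≤⇒0≤- {p} {q} p≤q = subst (_≤ q - p) (+-inverseʳ p) (+-monoˡ-≤ (- p) p≤q)

  0≤*-nonNeg : ∀ c .{{_ : NonNegative c}} {a} → 0ℚ ≤ a → 0ℚ ≤ c * a
  0≤*-nonNeg c {a} 0≤a = subst (_≤ c * a) (*-zeroʳ c) (*-monoˡ-≤-nonNeg c 0≤a)

  -- 11 (d − t/2) = 11 ((r + d) − t) + (3t − 11r) + (5/2) t, a sum of non-negative terms.
  half≤ : ∀ {t r d} → 0ℚ ≤ t → ℕtoℚ 11 * r ≤ ℕtoℚ 3 * t → t ≤ r + d → t * ½ ≤ d
  half≤ {t} {r} {d} 0≤t 11r≤3t t≤r+d = 0≤-⇒≤ (*-cancelˡ-≤-pos (ℕtoℚ 11) (subst₂ _≤_ (sym (*-zeroʳ (ℕtoℚ 11))) combination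
    (+-mono-≤ (+-mono-≤ (0≤*-nonNeg (ℕtoℚ 11) (≤⇒0≤- t≤r+d)) (≤⇒0≤- 11r≤3t)) (0≤*-nonNeg ((+ 5) / 2) 0≤t))))
    where
    combination : ℕtoℚ 11 * ((r + d) - t) + (ℕtoℚ 3 * t - ℕtoℚ 11 * r) + ((+ 5) / 2) * t ≡ ℕtoℚ 11 * (d - t * ½)
    combination = solve 3 (λ t r d → con (ℕtoℚ 11) :* ((r :+ d) :- t) :+ (con (ℕtoℚ 3) :* t :- con (ℕtoℚ 11) :* r)
                                     :+ con ((+ 5) / 2) :* t := con (ℕtoℚ 11) :* (d :- t :* con ½)) refl t r d

  11*removed≤ : ∀ E .{{_ : Positive E}} {Th R n} → (ℕtoℚ 11 ÷ E) {{pos⇒nonZero E}} ≤ ℕtoℚ Th →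
    Th ℕ.* R ℕ.≤ 12 ℕ.* n → ℕtoℚ 11 * ℕtoℚ R ≤ E * (ℕtoℚ 12 * ℕtoℚ n)
  11*removed≤ E {Th} {R} {n} s≤Th Th*R≤12n = begin
    ℕtoℚ 11 * ℕtoℚ R    ≡⟨ cong (_* ℕtoℚ R) s*E≡11 ⟨
    (s * E) * ℕtoℚ R    ≡⟨ solve 3 (λ s E R → (s :* E) :* R := E :* (s :* R)) refl s E (ℕtoℚ R) ⟩
    E * (s * ℕtoℚ R)    ≤⟨ *-monoˡ-≤-nonNeg E {{pos⇒nonNeg E}} s*R≤12n ⟩
    E * (ℕtoℚ 12 * ℕtoℚ n) ∎
    where
    open ≤-Reasoning
    instance
      E≢0 : NonZero E
      E≢0 = pos⇒nonZero E
    s : ℚ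
    s = ℕtoℚ 11 ÷ E
    s*E≡11 : s * E ≡ ℕtoℚ 11
    s*E≡11 = trans (*-assoc (ℕtoℚ 11) (1/ E) E) (trans (cong (ℕtoℚ 11 *_) (*-inverseˡ E)) (*-identityʳ (ℕtoℚ 11)))
    s*R≤12n : s * ℕtoℚ R ≤ ℕtoℚ 12 * ℕtoℚ n
    s*R≤12n = begin
      s * ℕtoℚ R              ≤⟨ *-monoʳ-≤-nonNeg (ℕtoℚ R) {{normalize-nonNeg R 1}} s≤Th ⟩
      ℕtoℚ Th * ℕtoℚ R        ≡⟨ ℕtoℚ-* Th R ⟨
      ℕtoℚ (Th ℕ.* R)         ≤⟨ ℕtoℚ-mono-≤ Th*R≤12n ⟩
      ℕtoℚ (12 ℕ.* n)         ≡⟨ ℕtoℚ-* 12 n ⟩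
      ℕtoℚ 12 * ℕtoℚ n        ∎

  distance-halves : ∀ ε (ε>0 : 0ℚ < ε) {n d d' R Th} →
    (ℕtoℚ 11 ÷ quarter ε) {{pos⇒nonZero (quarter ε) {{quarter-pos ε ε>0}}}} ≤ ℕtoℚ Th →
    Th ℕ.* R ℕ.≤ 12 ℕ.* n → d ℕ.≤ R ℕ.+ d' → ε * ℕtoℚ n ≤ ℕtoℚ d → (ε * ℕtoℚ n) * ½ ≤ ℕtoℚ d'
  distance-halves ε ε>0 {n} {d} {d'} {R} {Th} s≤Th Th*R≤12n d≤R+d' εn≤d = half≤ {ε * ℕtoℚ n} {ℕtoℚ R} {ℕtoℚ d'} 0≤εn 11R≤3εn (begin
    ε * ℕtoℚ n            ≤⟨ εn≤d ⟩
    ℕtoℚ d                ≤⟨ ℕtoℚ-mono-≤ d≤R+d' ⟩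
    ℕtoℚ (R ℕ.+ d')       ≡⟨ ℕtoℚ-+ R d' ⟩
    ℕtoℚ R + ℕtoℚ d'      ∎)
    where
    open ≤-Reasoning
    instance
      ε-pos : Positive ε
      ε-pos = positive ε>0
      E-pos : Positive (quarter ε)
      E-pos = quarter-pos ε ε>0
    0≤εn : 0ℚ ≤ ε * ℕtoℚ n
    0≤εn = 0≤*-nonNeg ε {{pos⇒nonNeg ε}} (ℕtoℚ-nonNeg n)
    11R≤3εn : ℕtoℚ 11 * ℕtoℚ R ≤ ℕtoℚ 3 * (ε * ℕtoℚ n)
    11R≤3εn = begin
      ℕtoℚ 11 * ℕtoℚ R                ≤⟨ 11*removed≤ (quarter ε) {Th} {R} {n} s≤Th Th*R≤12n ⟩
      quarter ε * (ℕtoℚ 12 * ℕtoℚ n)  ≡⟨ solve 2 (λ ε n → (ε :* con ((+ 1) / 4)) :* (con (ℕtoℚ 12) :* n) := con (ℕtoℚ 3) :* (ε :* n)) refl ε (ℕtoℚ n) ⟩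
      ℕtoℚ 3 * (ε * ℕtoℚ n)           ∎

open import Data.Bool using (Bool; true)
open import Data.Nat as ℕ using (ℕ)
open import Data.Rational using (ℚ; 0ℚ; 1ℚ; _<_; _≤_; _*_; _/_; _÷_)
open import Data.Rational.Properties using (pos⇒nonZero)
open import Data.Integer using (+_)
open import Data.Product using (∃; _×_; _,_; proj₁; proj₂)
open import Relation.Binary.PropositionalEquality using (_≡_; refl)
open Combinatorics using (exceeds; module Construction; Partition-G'≡Construction-G'; IsDist-cong; construction-distance-zero; construction-distance-bound)
open RationalBound using (threshold; distance-halves)

corollary1 : (ε : ℚ) (ε>0 : 0ℚ < ε) → ε < 1ℚ →
    (n : ℕ) (G H : Adj n) → IsForest G → IsForest H →
    (dGH dG'H' : ℕ) →
    IsDist G H dGH →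
    IsDist (partitionConstruction (quarter ε) {{quarter-pos ε ε>0}} G)
           (partitionConstruction (quarter ε) {{quarter-pos ε ε>0}} H) dG'H' →
    (dGH ≡ 0 → dG'H' ≡ 0) ×
    (ε * ℕtoℚ n ≤ ℕtoℚ dGH → (ε * ℕtoℚ n) * ((+ 1) / 2) ≤ ℕtoℚ dG'H')
corollary1 ε ε>0 _ n G H forest-G forest-H dGH dG'H' dist dist-partition =
  (λ { refl → construction-distance-zero P P forest-G forest-H dist dist' }) ,
  distance-halves ε ε>0 {n} {dGH} {dG'H'} {proj₁ bound} {Th} s≤Th (proj₁ (proj₂ bound)) (proj₂ (proj₂ bound))
  where
  s : ℚ
  s = (ℕtoℚ 11 ÷ quarter ε) {{pos⇒nonZero (quarter ε) {{quarter-pos ε ε>0}}}}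
  P : ℕ → Bool
  P = exceeds s
  dist' : IsDist (Construction.G' P P G) (Construction.G' P P H) dG'H'
  dist' = IsDist-cong (Partition-G'≡Construction-G' s G) (Partition-G'≡Construction-G' s H) dist-partition
  Th : ℕ
  Th = proj₁ (threshold s)
  s≤Th : s ≤ ℕtoℚ Th
  s≤Th = proj₁ (proj₂ (threshold s))
  exceeds⇒Th≤ : ∀ d → P d ≡ true → Th ℕ.≤ d
  exceeds⇒Th≤ = proj₂ (proj₂ (threshold s))
  bound : ∃ λ R → Th ℕ.* R ℕ.≤ 12 ℕ.* n × dGH ℕ.≤ R ℕ.+ dG'H'
  bound = construction-distance-bound P P forest-G forest-H Th exceeds⇒Th≤ exceeds⇒Th≤ dist dist'
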